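{- Let $\mathbb{H}$ be the random 3-partite 3-uniform hypergraph on vertex set $V_1\cup V_2\cup V_3$ with $|V_1|=|V_2|=|V_3|=n$, in which each of the $n^3$ triples containing exactly one vertex from each $V_i$ is an edge independently with probability $1/2$. Then there exists a constant $\gamma>0$ such that, with probability tending to $1$ as $n\to\infty$, $\mathbb{H}$ contains at least $\gamma n^2$ pairwise edge-disjoint perfect matchings.
   Context: A perfect matching of $\mathbb{H}$ is a set of pairwise vertex-disjoint edges of $\mathbb{H}$ covering all $3n$ vertices. -}

module Defs where

open import Data.Nat using (ℕ; suc; _+_; _*_; _∸_; _^_; _≤_)
open import Data.Fin using (Fin)
open import Data.Bool using (Bool; true)
open import Data.Empty using (⊥)
open import Data.Product using (_×_; _,_; Σ; ∃; ∃-syntax)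
open import Data.List using (List; length)
open import Data.List.Relation.Unary.All using (All)
open import Data.List.Relation.Unary.Unique.Propositional using (Unique)
open import Relation.Binary.PropositionalEquality using (_≡_; _≢_)

-- A triple with exactly one vertex from each of V₁, V₂, V₃ (each identified with Fin n).
Triple : ℕ → Set
Triple n = Fin n × Fin n × Fin n

Hypergraph : ℕ → Set
Hypergraph n = Triple n → Bool

TripleSet : ℕ → Set
TripleSet n = Triple n → Bool

VertexDisjoint : ∀ {n} → Triple n → Triple n → Set
VertexDisjoint (a , b , c) (a' , b' , c') = (a ≢ a') × (b ≢ b') × (c ≢ c')

IsPerfectMatching : ∀ {n} → Hypergraph n → TripleSet n → Set
IsPerfectMatching {n} H M =
    (∀ e → M e ≡ true → H e ≡ true)
  × (∀ e e' → M e ≡ true → M e' ≡ true → e ≢ e' → VertexDisjoint e e')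
  × (∀ (x : Fin n) → ∃[ b ] ∃[ c ] M (x , b , c) ≡ true)
  × (∀ (y : Fin n) → ∃[ a ] ∃[ c ] M (a , y , c) ≡ true)
  × (∀ (z : Fin n) → ∃[ a ] ∃[ b ] M (a , b , z) ≡ true)

-- H contains at least (p/q)·n² pairwise edge-disjoint perfect matchings:
-- a family of k perfect matchings, indexed by Fin k, pairwise sharing no edge,
-- with p·n² ≤ q·k.
HasManyDisjointPMs : (p q n : ℕ) → Hypergraph n → Set
HasManyDisjointPMs p q n H =
  Σ ℕ λ k → Σ (Fin k → TripleSet n) λ Ms →
      (p * (n * n) ≤ q * k)
    × (∀ i → IsPerfectMatching H (Ms i))
    × (∀ i j → i ≢ j → ∀ e → Ms i e ≡ true → Ms j e ≡ true → ⊥)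

module Submission where

-- Identify V₁, V₂, V₃ with Fin n and let ⊕ be addition mod n.  The slice G_s (s ∈ Fin n) is
-- the bipartite graph on V₁ × V₃ with a ~ c iff (a, a ⊕ s, c) is an edge; a hypergraph is
-- the same as its family of n slices.  A bipartite graph with minimum degree ≥ k + D and > k·n + n edges
--    between any two D-sets has k edge-disjoint perfect matchings (greedily: a bijection is
--    improved by one or two transpositions until it is a matching, then its edges are deleted).
--  * Lifting.  Matchings π of the slices lift to perfect matchings {(a, a ⊕ s, π a)}.
--  * Counting.  An atypical hypergraph satisfies one of 2n² + n·4ⁿ events "slice s has
--    < L edges in the cell set Z".  Markov's inequality for the weight 2^(non-edges in Z)
--    shows each such event holds for ≤ 2^L·2^(n³)·(3/4)^|Z|/2 hypergraphs; a union bound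
--    and elementary estimates with k = ⌊n/32⌋, D = 10k conclude (γ = 1/64).

open import Defs
import Algebra.Properties.CommutativeMonoid.Sum as MonoidSum
open import Data.Bool using (Bool; true; false; not; _∧_; _∨_; T)
import Data.Bool.Properties as Boolₚ
open import Data.Empty using (⊥; ⊥-elim)
open import Data.Fin using (Fin; zero; suc; _≟_; toℕ; fromℕ<; remQuot; combine)
import Data.Fin.Properties as Finₚ
open import Data.Fin.Permutation
  using (Permutation′; _⟨$⟩ʳ_; _⟨$⟩ˡ_; inverseˡ; inverseʳ; transpose; _∘ₚ_; flip)
  renaming (id to idₚ)
import Data.Fin.Permutation.Components as PermComponents
import Data.Vec.Functional as Vector
open import Data.List using (List; []; _∷_; _++_; map; length; concatMap; allFin; filterᵇ)
import Data.List.Properties as Listₚ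
open import Data.List.Relation.Unary.All as All using (All; []; _∷_)
import Data.List.Relation.Unary.All.Properties as Allₚ
open import Data.List.Relation.Unary.AllPairs as AllPairs using (AllPairs; []; _∷_)
import Data.List.Relation.Unary.AllPairs.Properties as AllPairsₚ
open import Data.List.Relation.Unary.Any as Any using (Any; here; there)
import Data.List.Relation.Unary.Any.Properties as Anyₚ
open import Data.List.Membership.Propositional.Properties using (∈-allFin)
open import Data.List.Relation.Unary.Unique.Propositional using (Unique)
open import Data.Nat hiding (_≟_)
open import Data.Nat.Properties hiding (_≟_)
open import Algebra.Properties.CommutativeSemigroup +-commutativeSemigroup using () renaming (interchange to +-interchange)
open import Data.Nat.DivMod
open import Data.Nat.Solver using (module +-*-Solver)
open import Data.Product using (Σ; _×_; _,_; proj₁; proj₂; ∃-syntax; uncurry)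
open import Data.Sum using (_⊎_; inj₁; inj₂)
open import Data.Unit using (tt)
open import Function using (_∘_; Equivalence)
open import Relation.Nullary using (yes; no; Dec; does)
open import Relation.Nullary.Decidable using (dec-true; dec-false)
open import Relation.Binary.PropositionalEquality

module ∑ℕ = MonoidSum +-0-commutativeMonoid
module ∏ℕ = MonoidSum *-1-commutativeMonoid

∑ : ∀ {n} → (Fin n → ℕ) → ℕ
∑ = ∑ℕ.sum

∏ : ∀ {n} → (Fin n → ℕ) → ℕ
∏ = ∏ℕ.sum

bit : Bool → ℕ
bit true = 1
bit false = 0

count : ∀ {n} → (Fin n → Bool) → ℕ
count p = ∑ (λ i → bit (p i))

∑-cong : ∀ {n} {f g : Fin n → ℕ} → (∀ i → f i ≡ g i) → ∑ f ≡ ∑ g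
∑-cong = ∑ℕ.sum-cong-≗

∏-cong : ∀ {n} {f g : Fin n → ℕ} → (∀ i → f i ≡ g i) → ∏ f ≡ ∏ g
∏-cong = ∏ℕ.sum-cong-≗

count-cong : ∀ {n} {p q : Fin n → Bool} → (∀ i → p i ≡ q i) → count p ≡ count q
count-cong e = ∑-cong (λ i → cong bit (e i))

∑-+ : ∀ {n} (f g : Fin n → ℕ) → ∑ (λ i → f i + g i) ≡ ∑ f + ∑ g
∑-+ = ∑ℕ.∑-distrib-+

∏-* : ∀ {n} (f g : Fin n → ℕ) → ∏ (λ i → f i * g i) ≡ ∏ f * ∏ g
∏-* = ∏ℕ.∑-distrib-+

∑-*ˡ : ∀ {n} (c : ℕ) (f : Fin n → ℕ) → ∑ (λ i → c * f i) ≡ c * ∑ f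
∑-*ˡ {zero} c f = sym (*-zeroʳ c)
∑-*ˡ {suc n} c f = trans (cong (c * f zero +_) (∑-*ˡ c (f ∘ suc))) (sym (*-distribˡ-+ c (f zero) _))

∑-const : ∀ {n} (c : ℕ) → ∑ {n} (λ _ → c) ≡ n * c
∑-const {zero} c = refl
∑-const {suc n} c = cong (c +_) (∑-const {n} c)

∏-const : ∀ {n} (c : ℕ) → ∏ {n} (λ _ → c) ≡ c ^ n
∏-const {zero} c = refl
∏-const {suc n} c = cong (c *_) (∏-const {n} c)

^-∑ : ∀ {n} (m : ℕ) (f : Fin n → ℕ) → m ^ ∑ f ≡ ∏ (λ i → m ^ f i)
^-∑ {zero} m f = refl
^-∑ {suc n} m f = trans (^-distribˡ-+-* m (f zero) _) (cong (m ^ f zero *_) (^-∑ m (f ∘ suc)))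

∑-mono-≤ : ∀ {n} {f g : Fin n → ℕ} → (∀ i → f i ≤ g i) → ∑ f ≤ ∑ g
∑-mono-≤ {zero} e = ≤-refl
∑-mono-≤ {suc n} e = +-mono-≤ (e zero) (∑-mono-≤ (e ∘ suc))

∑-mono-< : ∀ {n} {f g : Fin n → ℕ} → (∀ i → f i ≤ g i) → (u : Fin n) → f u < g u → ∑ f < ∑ g
∑-mono-< {suc n} e zero lt = +-mono-<-≤ lt (∑-mono-≤ (e ∘ suc))
∑-mono-< {suc n} e (suc u) lt = +-mono-≤-< (e zero) (∑-mono-< (e ∘ suc) u lt)

∑-pos : ∀ {n} (f : Fin n → ℕ) → 1 ≤ ∑ f → ∃[ i ] 1 ≤ f i
∑-pos {suc n} f h with f zero in eq
... | suc x = zero , subst (1 ≤_) (sym eq) (s≤s z≤n)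
... | zero with ∑-pos (f ∘ suc) h
...   | i , p = suc i , p

∑-≤-+n : ∀ {n} (f g : Fin n → ℕ) → (∀ i → f i ≤ g i + 1) → ∑ f ≤ ∑ g + n
∑-≤-+n {n} f g h = subst (∑ f ≤_) (trans (∑-+ g (λ _ → 1)) (cong (∑ g +_) (trans (∑-const {n} 1) (*-identityʳ n)))) (∑-mono-≤ h)

bit≤1 : ∀ b → bit b ≤ 1
bit≤1 true = ≤-refl
bit≤1 false = z≤n

bit-∧ : ∀ a b → bit (a ∧ b) ≡ bit a * bit b
bit-∧ true b = sym (+-identityʳ (bit b))
bit-∧ false b = refl

count-∧ˡ : ∀ {n} (b : Bool) (p : Fin n → Bool) → count (λ i → b ∧ p i) ≡ bit b * count p
count-∧ˡ b p = trans (∑-cong (λ i → bit-∧ b (p i))) (∑-*ˡ (bit b) (λ i → bit (p i)))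

count-pos : ∀ {n} (p : Fin n → Bool) → 1 ≤ count p → ∃[ i ] p i ≡ true
count-pos p h with ∑-pos (λ i → bit (p i)) h
... | i , q = i , bit-pos (p i) q
  where
  bit-pos : ∀ b → 1 ≤ bit b → b ≡ true
  bit-pos true _ = refl

count-false : ∀ {n} (p : Fin n → Bool) (i : Fin n) → p i ≡ false → count p < n
count-false {n} p i e = subst (count p <_) (trans (∑-const {n} 1) (*-identityʳ n))
  (∑-mono-< (λ j → bit≤1 (p j)) i (subst (λ b → bit b < 1) (sym e) (s≤s z≤n)))

count-split : ∀ {n} (p q : Fin n → Bool) → count (λ i → p i ∧ q i) + count (λ i → p i ∧ not (q i)) ≡ count p
count-split p q = trans (sym (∑-+ (λ i → bit (p i ∧ q i)) (λ i → bit (p i ∧ not (q i))))) (∑-cong (λ i → split (p i) (q i)))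
  where
  split : ∀ a b → bit (a ∧ b) + bit (a ∧ not b) ≡ bit a
  split true true = refl
  split true false = refl
  split false b = refl

infix 4 _=ᵇ_
_=ᵇ_ : ∀ {n} → Fin n → Fin n → Bool
i =ᵇ j = does (i ≟ j)

=ᵇ-refl : ∀ {n} (i : Fin n) → (i =ᵇ i) ≡ true
=ᵇ-refl i = dec-true (i ≟ i) refl

=ᵇ-≢ : ∀ {n} {i j : Fin n} → i ≢ j → (i =ᵇ j) ≡ false
=ᵇ-≢ {i = i} {j} = dec-false (i ≟ j)

=ᵇ-true : ∀ {n} {i j : Fin n} → (i =ᵇ j) ≡ true → i ≡ j
=ᵇ-true {i = i} {j} e with i ≟ j | e
... | yes i≡j | _ = i≡j
... | no _ | ()

∑-δ : ∀ {n} (j : Fin n) (f : Fin n → ℕ) → ∑ (λ i → bit (i =ᵇ j) * f i) ≡ f j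
∑-δ {suc n} zero f = begin
  bit (_=ᵇ_ {suc n} zero zero) * f zero + ∑ (λ i → bit (suc i =ᵇ zero) * f (suc i))
    ≡⟨ cong₂ _+_ (cong (λ b → bit b * f zero) (=ᵇ-refl {suc n} zero))
                 (∑-cong (λ i → cong (λ b → bit b * f (suc i)) (=ᵇ-≢ {i = suc i} {zero} (λ ())))) ⟩
  f zero + 0 + ∑ {n} (λ _ → 0) ≡⟨ cong (f zero + 0 +_) (trans (∑-const {n} 0) (*-zeroʳ n)) ⟩
  f zero + 0 + 0 ≡⟨ trans (+-identityʳ _) (+-identityʳ _) ⟩
  f zero ∎
  where open ≡-Reasoning
∑-δ {suc n} (suc j) f =
  trans (cong (λ b → bit b * f zero + ∑ (λ i → bit (i =ᵇ j) * f (suc i))) (=ᵇ-≢ {i = zero} {suc j} (λ ())))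
        (∑-δ j (f ∘ suc))

count-δ : ∀ {n} (j : Fin n) (p : Fin n → Bool) → count (λ i → (i =ᵇ j) ∧ p i) ≡ bit (p j)
count-δ j p = trans (∑-cong (λ i → bit-∧ (i =ᵇ j) (p i))) (∑-δ j (λ i → bit (p i)))

count-singleton : ∀ {n} (j : Fin n) → count (λ i → i =ᵇ j) ≡ 1
count-singleton j = trans (count-cong (λ i → sym (Boolₚ.∧-identityʳ (i =ᵇ j)))) (count-δ j (λ _ → true))

∧-true : ∀ {a b} → a ≡ true → b ≡ true → (a ∧ b) ≡ true
∧-true refl refl = refl

∧-trueˡ : ∀ {a b} → (a ∧ b) ≡ true → a ≡ true
∧-trueˡ = Boolₚ.∧-conicalˡ _ _

∧-trueʳ : ∀ {a b} → (a ∧ b) ≡ true → b ≡ true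
∧-trueʳ = Boolₚ.∧-conicalʳ _ _

not-true : ∀ {a} → not a ≡ true → a ≡ false
not-true {false} _ = refl

not-false : ∀ {a} → not a ≡ false → a ≡ true
not-false {true} _ = refl

true≢false : ∀ {a} → a ≡ true → a ≡ false → ⊥
true≢false refl ()

∧₄-true : ∀ {a b c d} → (((a ∧ b) ∧ c) ∧ d) ≡ true → (a ≡ true) × (b ≡ true) × (c ≡ true) × (d ≡ true)
∧₄-true {true} {true} {true} {true} _ = refl , refl , refl , refl

search : ∀ {n} (p : Fin n → Bool) → (∃[ i ] p i ≡ true) ⊎ (∀ i → p i ≡ false)
search p with Finₚ.any? (λ i → p i Boolₚ.≟ true)
... | yes found = inj₁ found
... | no none = inj₂ (λ i → Boolₚ.¬-not (λ pi → none (i , pi)))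

swap : ∀ {n} → Fin n → Fin n → Fin n → Fin n
swap = PermComponents.transpose

swap-matchˡ : ∀ {n} (i j : Fin n) → swap i j i ≡ j
swap-matchˡ i j rewrite dec-true (i ≟ i) refl = refl

swap-matchʳ : ∀ {n} (i j : Fin n) → swap i j j ≡ i
swap-matchʳ i j with j ≟ i
... | yes j≡i = j≡i
... | no _ rewrite dec-true (j ≟ j) refl = refl

swap-other : ∀ {n} {i j w : Fin n} → w ≢ i → w ≢ j → swap i j w ≡ w
swap-other {i = i} {j} {w} w≢i w≢j rewrite dec-false (w ≟ i) w≢i | dec-false (w ≟ j) w≢j = refl

BipGraph : ℕ → Set
BipGraph n = Fin n → Fin n → Bool

rowDeg : ∀ {n} → BipGraph n → Fin n → ℕ
rowDeg g a = count (g a)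

colDeg : ∀ {n} → BipGraph n → Fin n → ℕ
colDeg g c = count (λ a → g a c)

edgesBetween : ∀ {n} → BipGraph n → (Fin n → Bool) → (Fin n → Bool) → ℕ
edgesBetween g A B = ∑ (λ a → count (λ c → (A a ∧ B c) ∧ g a c))

WellConnected : ∀ {n} → BipGraph n → ℕ → ℕ → ℕ → Set
WellConnected g D d L =
    (∀ a → d ≤ rowDeg g a)
  × (∀ c → d ≤ colDeg g c)
  × (∀ A B → D ≤ count A → D ≤ count B → L ≤ edgesBetween g A B)

well-connected-weaken : ∀ {n} {g : BipGraph n} {D d d' L L'} →
  d' ≤ d → L' ≤ L → WellConnected g D d L → WellConnected g D d' L'
well-connected-weaken d'≤d L'≤L (rows , cols , pairs) =
  (λ a → ≤-trans d'≤d (rows a)) , (λ c → ≤-trans d'≤d (cols c)) , λ A B hA hB → ≤-trans L'≤L (pairs A B hA hB)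

IsMatching : ∀ {n} → BipGraph n → Permutation′ n → Set
IsMatching g π = ∀ a → g a (π ⟨$⟩ʳ a) ≡ true

count-drop-one : ∀ {n} (h : Fin n → Bool) (t : Fin n) → count h ≤ count (λ c → h c ∧ not (c =ᵇ t)) + 1
count-drop-one h t = begin
  count h                                              ≡⟨ count-split h (λ c → not (c =ᵇ t)) ⟨
  count (λ c → h c ∧ not (c =ᵇ t)) + count (λ c → h c ∧ not (not (c =ᵇ t)))
    ≡⟨ cong (count (λ c → h c ∧ not (c =ᵇ t)) +_)
            (count-cong (λ c → trans (cong (h c ∧_) (Boolₚ.not-involutive (c =ᵇ t))) (Boolₚ.∧-comm (h c) (c =ᵇ t)))) ⟩
  count (λ c → h c ∧ not (c =ᵇ t)) + count (λ c → (c =ᵇ t) ∧ h c) ≡⟨ cong (count (λ c → h c ∧ not (c =ᵇ t)) +_) (count-δ t h) ⟩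
  count (λ c → h c ∧ not (c =ᵇ t)) + bit (h t)        ≤⟨ +-monoʳ-≤ _ (bit≤1 (h t)) ⟩
  count (λ c → h c ∧ not (c =ᵇ t)) + 1 ∎
  where open ≤-Reasoning

-- Any function f : Fin n → Fin n meets at most n edges, so e(A, B) > n yields an edge
-- a ~ c with a ∈ A, c ∈ B and c ≠ f a.
edge-off-function : ∀ {n} (g : BipGraph n) (A B : Fin n → Bool) (f : Fin n → Fin n) →
  suc n ≤ edgesBetween g A B →
  ∃[ a ] ∃[ c ] (A a ≡ true) × (B c ≡ true) × (g a c ≡ true) × (c ≢ f a)
edge-off-function {n} g A B f n<e = edge (∑-pos offDiagonal one≤offDiagonal)
  where
  edgeOff : Fin n → Fin n → Bool
  edgeOff a c = ((A a ∧ B c) ∧ g a c) ∧ not (c =ᵇ f a)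
  offDiagonal : Fin n → ℕ
  offDiagonal a = count (edgeOff a)
  one≤offDiagonal : 1 ≤ ∑ offDiagonal
  one≤offDiagonal = +-cancelʳ-≤ n 1 (∑ offDiagonal)
    (≤-trans n<e (∑-≤-+n _ offDiagonal (λ a → count-drop-one (λ c → (A a ∧ B c) ∧ g a c) (f a))))
  edge : ∃[ a ] 1 ≤ offDiagonal a → ∃[ a ] ∃[ c ] (A a ≡ true) × (B c ≡ true) × (g a c ≡ true) × (c ≢ f a)
  edge (a , pos) with count-pos (edgeOff a) pos
  ... | c , hit with ∧₄-true {A a} {B c} {g a c} hit
  ...   | Aa , Bc , gac , c≠fa =
          a , c , Aa , Bc , gac , λ c≡fa → true≢false (subst (λ x → (c =ᵇ x) ≡ true) c≡fa (=ᵇ-refl c)) (not-true c≠fa)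

-- Finding one perfect matching.  Rows a with a ~ π a are "matched" by π; we repeatedly
-- replace π by a permutation matching strictly more rows.

matchedRows : ∀ {n} → BipGraph n → Permutation′ n → ℕ
matchedRows g π = count (λ a → g a (π ⟨$⟩ʳ a))

Improves : ∀ {n} → BipGraph n → Permutation′ n → Permutation′ n → Set
Improves g π π' =
    (∀ w → g w (π ⟨$⟩ʳ w) ≡ true → g w (π' ⟨$⟩ʳ w) ≡ true)
  × ∃[ z ] (g z (π ⟨$⟩ʳ z) ≡ false) × (g z (π' ⟨$⟩ʳ z) ≡ true)

improves-matchedRows : ∀ {n} {g : BipGraph n} {π π'} → Improves g π π' → matchedRows g π < matchedRows g π'
improves-matchedRows {g = g} {π} {π'} (kept , z , before , after) = ∑-mono-< pointwise z strictly
  where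
  pointwise : ∀ w → bit (g w (π ⟨$⟩ʳ w)) ≤ bit (g w (π' ⟨$⟩ʳ w))
  pointwise w with g w (π ⟨$⟩ʳ w) in eq
  ... | false = z≤n
  ... | true rewrite kept w eq = ≤-refl
  strictly : bit (g z (π ⟨$⟩ʳ z)) < bit (g z (π' ⟨$⟩ʳ z))
  strictly rewrite before | after = s≤s z≤n

matched≢unmatched : ∀ {n} {g : BipGraph n} {π : Permutation′ n} {w u} →
  g w (π ⟨$⟩ʳ w) ≡ true → g u (π ⟨$⟩ʳ u) ≡ false → w ≢ u
matched≢unmatched {g = g} {π} w-matched u-unmatched refl = true≢false w-matched u-unmatched

swap-improves : ∀ {n} {g : BipGraph n} {π : Permutation′ n} {u v} →
  g u (π ⟨$⟩ʳ u) ≡ false → g v (π ⟨$⟩ʳ v) ≡ false → g u (π ⟨$⟩ʳ v) ≡ true →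
  Improves g π (transpose u v ∘ₚ π)
swap-improves {g = g} {π} {u} {v} u-unmatched v-unmatched u~πv = kept , u , u-unmatched , u-matched
  where
  kept : ∀ w → g w (π ⟨$⟩ʳ w) ≡ true → g w (π ⟨$⟩ʳ swap u v w) ≡ true
  kept w w-matched = subst (λ x → g w (π ⟨$⟩ʳ x) ≡ true)
    (sym (swap-other (matched≢unmatched {g = g} {π} w-matched u-unmatched) (matched≢unmatched {g = g} {π} w-matched v-unmatched))) w-matched
  u-matched : g u (π ⟨$⟩ʳ swap u v u) ≡ true
  u-matched = subst (λ x → g u (π ⟨$⟩ʳ x) ≡ true) (sym (swap-matchˡ u v)) u~πv

rotate-improves : ∀ {n} {g : BipGraph n} {π : Permutation′ n} {u a y} →
  g u (π ⟨$⟩ʳ u) ≡ false → g a (π ⟨$⟩ʳ a) ≡ true → g y (π ⟨$⟩ʳ y) ≡ true → a ≢ y →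
  g u (π ⟨$⟩ʳ a) ≡ true → g a (π ⟨$⟩ʳ y) ≡ true → g y (π ⟨$⟩ʳ u) ≡ true →
  Improves g π (transpose a y ∘ₚ (transpose u a ∘ₚ π))
rotate-improves {g = g} {π} {u} {a} {y} u-unmatched a-matched y-matched a≢y u~πa a~πy y~πu =
  kept , u , u-unmatched , at-u
  where
  ρ : Fin _ → Fin _
  ρ w = π ⟨$⟩ʳ swap u a (swap a y w)
  u≢a : u ≢ a
  u≢a e = matched≢unmatched {g = g} {π} a-matched u-unmatched (sym e)
  u≢y : u ≢ y
  u≢y e = matched≢unmatched {g = g} {π} y-matched u-unmatched (sym e)
  at-u : g u (ρ u) ≡ true
  at-u = subst (λ x → g u (π ⟨$⟩ʳ x) ≡ true)
    (sym (trans (cong (swap u a) (swap-other u≢a u≢y)) (swap-matchˡ u a))) u~πa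
  at-a : g a (ρ a) ≡ true
  at-a = subst (λ x → g a (π ⟨$⟩ʳ x) ≡ true)
    (sym (trans (cong (swap u a) (swap-matchˡ a y)) (swap-other (u≢y ∘ sym) (a≢y ∘ sym)))) a~πy
  at-y : g y (ρ y) ≡ true
  at-y = subst (λ x → g y (π ⟨$⟩ʳ x) ≡ true)
    (sym (trans (cong (swap u a) (swap-matchʳ a y)) (swap-matchʳ u a))) y~πu
  kept : ∀ w → g w (π ⟨$⟩ʳ w) ≡ true → g w (ρ w) ≡ true
  kept w w-matched = by-cases (w ≟ a) (w ≟ y)
    where
    by-cases : Dec (w ≡ a) → Dec (w ≡ y) → g w (ρ w) ≡ true
    by-cases (yes refl) _ = at-a
    by-cases (no _) (yes refl) = at-y
    by-cases (no w≢a) (no w≢y) = subst (λ x → g w (π ⟨$⟩ʳ x) ≡ true)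
      (sym (trans (cong (swap u a) (swap-other w≢a w≢y)) (swap-other (matched≢unmatched {g = g} {π} w-matched u-unmatched) w≢a))) w-matched

count-permute : ∀ {n} (p : Fin n → Bool) (π : Permutation′ n) → count (λ i → p (π ⟨$⟩ʳ i)) ≡ count p
count-permute p π = sym (∑ℕ.sum-permute (λ i → bit (p i)) π)

inverse-unique : ∀ {n} (π : Permutation′ n) {a b} → π ⟨$⟩ʳ a ≡ b → a ≡ π ⟨$⟩ˡ b
inverse-unique π {a} refl = sym (inverseˡ π)

∧-not-false : ∀ {a b} → a ≡ true → (a ∧ not b) ≡ false → b ≡ true
∧-not-false {b = true} refl _ = refl

-- Let u be unmatched.  If some unmatched a has u ~ π a, or some
-- unmatched y has y ~ π u, one transposition suffices.  Otherwise the rows A = {a | u ~ π a}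
-- and the columns B = {π y | y ~ π u} consist of matched rows / images of matched rows,
-- have size ≥ D by the degree bounds, and so span an edge a ~ π y off the graph of π,
-- which closes the rotation u → a → y → u.
improve : ∀ {n} {g : BipGraph n} {D} → WellConnected g D D (suc n) →
  (π : Permutation′ n) (u : Fin n) → g u (π ⟨$⟩ʳ u) ≡ false → ∃[ π' ] Improves g π π'
improve {n} {g} {D} (rows , cols , pairs) π u u-unmatched
  with search (λ a → g u (π ⟨$⟩ʳ a) ∧ not (g a (π ⟨$⟩ʳ a)))
... | inj₁ (a , hit) =
  transpose u a ∘ₚ π , swap-improves {g = g} {π} u-unmatched (not-true (∧-trueʳ {g u (π ⟨$⟩ʳ a)} hit)) (∧-trueˡ {g u (π ⟨$⟩ʳ a)} hit)
... | inj₂ no-a with search (λ y → g y (π ⟨$⟩ʳ u) ∧ not (g y (π ⟨$⟩ʳ y)))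
...   | inj₁ (y , hit) =
  transpose y u ∘ₚ π , swap-improves {g = g} {π} (not-true (∧-trueʳ {g y (π ⟨$⟩ʳ u)} hit)) u-unmatched (∧-trueˡ {g y (π ⟨$⟩ʳ u)} hit)
...   | inj₂ no-y with edge-off-function g A B (π ⟨$⟩ʳ_) (pairs A B |A| |B|)
  where
  A B : Fin n → Bool
  A a = g u (π ⟨$⟩ʳ a)
  B b = g (π ⟨$⟩ˡ b) (π ⟨$⟩ʳ u)
  |A| : D ≤ count A
  |A| = subst (D ≤_) (sym (count-permute (g u) π)) (rows u)
  |B| : D ≤ count B
  |B| = subst (D ≤_) (sym (count-permute (λ y → g y (π ⟨$⟩ʳ u)) (flip π))) (cols (π ⟨$⟩ʳ u))
...     | a , b , u~πa , y~πu , a~b , b≢πa =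
  transpose a (π ⟨$⟩ˡ b) ∘ₚ (transpose u a ∘ₚ π) ,
  rotate-improves {g = g} {π} u-unmatched (∧-not-false u~πa (no-a a)) (∧-not-false y~πu (no-y (π ⟨$⟩ˡ b)))
        (λ a≡y → b≢πa (sym (trans (cong (π ⟨$⟩ʳ_) a≡y) (inverseʳ π))))
        u~πa (subst (λ x → g a x ≡ true) (sym (inverseʳ π)) a~b) y~πu

perfect-matching : ∀ {n} {g : BipGraph n} {D} → WellConnected g D D (suc n) → ∃[ π ] IsMatching g π
perfect-matching {n} {g} wc = iterate n idₚ (m≤m+n n _)
  where
  iterate : (fuel : ℕ) (π : Permutation′ n) → n ≤ fuel + matchedRows g π → ∃[ π ] IsMatching g π
  iterate fuel π budget with search (λ a → not (g a (π ⟨$⟩ʳ a)))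
  ... | inj₂ none-unmatched = π , λ a → not-false (none-unmatched a)
  ... | inj₁ (u , unmatched) with fuel
  ...   | zero = ⊥-elim (<⇒≱ (count-false (λ a → g a (π ⟨$⟩ʳ a)) u (not-true unmatched)) budget)
  ...   | suc fuel with improve wc π u (not-true unmatched)
  ...     | π' , better = iterate fuel π' (≤-trans budget (≤-trans (≤-reflexive (sym (+-suc fuel (matchedRows g π))))
                            (+-monoʳ-≤ fuel (improves-matchedRows {g = g} {π} {π'} better))))

without : ∀ {n} → BipGraph n → Permutation′ n → BipGraph n
without g π a c = g a c ∧ not (c =ᵇ π ⟨$⟩ʳ a)

=ᵇ-inverse : ∀ {n} (π : Permutation′ n) (a c : Fin n) → (c =ᵇ π ⟨$⟩ʳ a) ≡ (a =ᵇ π ⟨$⟩ˡ c)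
=ᵇ-inverse π a c with c ≟ π ⟨$⟩ʳ a | a ≟ π ⟨$⟩ˡ c
... | yes _ | yes _ = refl
... | no _ | no _ = refl
... | yes c≡πa | no a≢π⁻¹c = ⊥-elim (a≢π⁻¹c (inverse-unique π (sym c≡πa)))
... | no c≢πa | yes a≡π⁻¹c = ⊥-elim (c≢πa (trans (sym (inverseʳ π)) (cong (π ⟨$⟩ʳ_) (sym a≡π⁻¹c))))

without-well-connected : ∀ {n} {g : BipGraph n} {D d L} (π : Permutation′ n) →
  WellConnected g D (suc d) (n + L) → WellConnected (without g π) D d L
without-well-connected {n} {g} {D} {d} {L} π (rows , cols , pairs) = rows' , cols' , pairs'
  where
  rows' : ∀ a → d ≤ rowDeg (without g π) a
  rows' a = +-cancelʳ-≤ 1 d _ (subst (_≤ rowDeg (without g π) a + 1) (+-comm 1 d)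
    (≤-trans (rows a) (count-drop-one (g a) (π ⟨$⟩ʳ a))))
  cols' : ∀ c → d ≤ colDeg (without g π) c
  cols' c = +-cancelʳ-≤ 1 d _ (subst (_≤ colDeg (without g π) c + 1) (+-comm 1 d)
    (≤-trans (cols c) (subst (λ x → colDeg g c ≤ x + 1)
      (sym (count-cong (λ a → cong (λ x → g a c ∧ not x) (=ᵇ-inverse π a c))))
      (count-drop-one (λ a → g a c) (π ⟨$⟩ˡ c)))))
  pairs' : ∀ A B → D ≤ count A → D ≤ count B → L ≤ edgesBetween (without g π) A B
  pairs' A B |A| |B| = +-cancelˡ-≤ n L _ (≤-trans (pairs A B |A| |B|) (begin
    edgesBetween g A B
      ≤⟨ ∑-≤-+n _ _ (λ a → count-drop-one (λ c → (A a ∧ B c) ∧ g a c) (π ⟨$⟩ʳ a)) ⟩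
    ∑ (λ a → count (λ c → ((A a ∧ B c) ∧ g a c) ∧ not (c =ᵇ π ⟨$⟩ʳ a))) + n
      ≡⟨ cong (_+ n) (∑-cong (λ a → count-cong (λ c → Boolₚ.∧-assoc (A a ∧ B c) (g a c) _))) ⟩
    edgesBetween (without g π) A B + n ≡⟨ +-comm _ n ⟩
    n + edgesBetween (without g π) A B ∎))
    where open ≤-Reasoning

DisjointMatchings : ∀ {n} → BipGraph n → ℕ → Set
DisjointMatchings {n} g r = Σ (Fin r → Permutation′ n) λ Π →
  (∀ i → IsMatching g (Π i)) × (∀ i j → i ≢ j → ∀ a → Π i ⟨$⟩ʳ a ≢ Π j ⟨$⟩ʳ a)

disjoint-matchings : ∀ {n} {D} (r : ℕ) (g : BipGraph n) →
  WellConnected g D (r + D) (r * n + suc n) → DisjointMatchings g r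
disjoint-matchings zero g wc = (λ ()) , (λ ()) , λ ()
disjoint-matchings {n} {D} (suc r) g wc = Π , matching , disjoint
  where
  first : ∃[ π ] IsMatching g π
  first = perfect-matching {g = g} {D = D}
    (well-connected-weaken (m≤n+m D (suc r)) (m≤n+m (suc n) (suc r * n)) wc)
  π = proj₁ first
  rest : DisjointMatchings (without g π) r
  rest = disjoint-matchings r (without g π)
    (without-well-connected π (subst (WellConnected g D (suc (r + D))) (+-assoc n (r * n) (suc n)) wc))
  Π : Fin (suc r) → Permutation′ n
  Π zero = π
  Π (suc i) = proj₁ rest i
  avoids-first : ∀ i a → proj₁ rest i ⟨$⟩ʳ a ≢ π ⟨$⟩ʳ a
  avoids-first i a e = true≢false (trans (cong (_=ᵇ π ⟨$⟩ʳ a) e) (=ᵇ-refl (π ⟨$⟩ʳ a)))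
    (not-true (∧-trueʳ {g a (proj₁ rest i ⟨$⟩ʳ a)} (proj₁ (proj₂ rest) i a)))
  matching : ∀ i → IsMatching g (Π i)
  matching zero = proj₂ first
  matching (suc i) a = ∧-trueˡ {g a (proj₁ rest i ⟨$⟩ʳ a)} (proj₁ (proj₂ rest) i a)
  disjoint : ∀ i j → i ≢ j → ∀ a → Π i ⟨$⟩ʳ a ≢ Π j ⟨$⟩ʳ a
  disjoint zero zero i≢j = ⊥-elim (i≢j refl)
  disjoint zero (suc j) _ a e = avoids-first j a (sym e)
  disjoint (suc i) zero _ a e = avoids-first i a e
  disjoint (suc i) (suc j) i≢j = proj₂ (proj₂ rest) i j (i≢j ∘ cong suc)

infixl 6 _⊕_ _⊖_

_⊕_ : ∀ {n} → Fin n → Fin n → Fin n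
_⊕_ {suc n} a s = fromℕ< (m%n<n (toℕ a + toℕ s) (suc n))

_⊖_ : ∀ {n} → Fin n → Fin n → Fin n
_⊖_ {suc n} b a = fromℕ< (m%n<n (toℕ b + (suc n ∸ toℕ a)) (suc n))

toℕ-⊕ : ∀ {n} (a s : Fin (suc n)) → toℕ (a ⊕ s) ≡ (toℕ a + toℕ s) % suc n
toℕ-⊕ {n} a s = Finₚ.toℕ-fromℕ< (m%n<n (toℕ a + toℕ s) (suc n))

toℕ-⊖ : ∀ {n} (b a : Fin (suc n)) → toℕ (b ⊖ a) ≡ (toℕ b + (suc n ∸ toℕ a)) % suc n
toℕ-⊖ {n} b a = Finₚ.toℕ-fromℕ< (m%n<n (toℕ b + (suc n ∸ toℕ a)) (suc n))

%-absorbˡ : ∀ m k d .{{_ : NonZero d}} → (m % d + k) % d ≡ (m + k) % d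
%-absorbˡ m k d = trans (%-distribˡ-+ (m % d) k d)
  (trans (cong (λ x → (x + k % d) % d) (m%n%n≡m%n m d)) (sym (%-distribˡ-+ m k d)))

⊕-⊖-cancelˡ : ∀ {n} (a s : Fin n) → a ⊕ s ⊖ a ≡ s
⊕-⊖-cancelˡ {suc n} a s = Finₚ.toℕ-injective (begin
  toℕ (a ⊕ s ⊖ a)                 ≡⟨ toℕ-⊖ (a ⊕ s) a ⟩
  (toℕ (a ⊕ s) + (N ∸ x)) % N     ≡⟨ cong (λ z → (z + (N ∸ x)) % N) (toℕ-⊕ a s) ⟩
  ((x + y) % N + (N ∸ x)) % N     ≡⟨ %-absorbˡ (x + y) (N ∸ x) N ⟩
  (x + y + (N ∸ x)) % N           ≡⟨ cong (_% N) (solve-x+y+[N∸x]) ⟩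
  (y + N) % N                     ≡⟨ [m+n]%n≡m%n y N ⟩
  y % N                           ≡⟨ m<n⇒m%n≡m (Finₚ.toℕ<n s) ⟩
  y ∎)
  where
  open ≡-Reasoning
  N = suc n
  x = toℕ a
  y = toℕ s
  solve-x+y+[N∸x] : x + y + (N ∸ x) ≡ y + N
  solve-x+y+[N∸x] = trans (cong (_+ (N ∸ x)) (+-comm x y))
    (trans (+-assoc y x (N ∸ x)) (cong (y +_) (m+[n∸m]≡n (<⇒≤ (Finₚ.toℕ<n a)))))

⊕-comm : ∀ {n} (a s : Fin n) → a ⊕ s ≡ s ⊕ a
⊕-comm {suc n} a s = Finₚ.toℕ-injective
  (trans (toℕ-⊕ a s) (trans (cong (_% suc n) (+-comm (toℕ a) (toℕ s))) (sym (toℕ-⊕ s a))))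

⊕-⊖-cancelʳ : ∀ {n} (a s : Fin n) → a ⊕ s ⊖ s ≡ a
⊕-⊖-cancelʳ a s = trans (cong (_⊖ s) (⊕-comm a s)) (⊕-⊖-cancelˡ s a)

⊖-⊕-cancel : ∀ {n} (y s : Fin n) → y ⊖ s ⊕ s ≡ y
⊖-⊕-cancel {suc n} y s = Finₚ.toℕ-injective (begin
  toℕ (y ⊖ s ⊕ s)                 ≡⟨ toℕ-⊕ (y ⊖ s) s ⟩
  (toℕ (y ⊖ s) + z) % N           ≡⟨ cong (λ w → (w + z) % N) (toℕ-⊖ y s) ⟩
  ((x + (N ∸ z)) % N + z) % N     ≡⟨ %-absorbˡ (x + (N ∸ z)) z N ⟩
  (x + (N ∸ z) + z) % N           ≡⟨ cong (_% N) (trans (+-assoc x (N ∸ z) z) (cong (x +_) (m∸n+n≡m (<⇒≤ (Finₚ.toℕ<n s))))) ⟩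
  (x + N) % N                     ≡⟨ [m+n]%n≡m%n x N ⟩
  x % N                           ≡⟨ m<n⇒m%n≡m (Finₚ.toℕ<n y) ⟩
  x ∎)
  where
  open ≡-Reasoning
  N = suc n
  x = toℕ y
  z = toℕ s

fromSlices : ∀ {n} → (Fin n → BipGraph n) → Hypergraph n
fromSlices G (a , b , c) = G (b ⊖ a) a c

liftMatching : ∀ {n} → Fin n → Permutation′ n → TripleSet n
liftMatching s π (x , y , z) = (y =ᵇ x ⊕ s) ∧ (z =ᵇ π ⟨$⟩ʳ x)

liftMatching-member : ∀ {n} {s : Fin n} {π x y z} →
  liftMatching s π (x , y , z) ≡ true → (y ≡ x ⊕ s) × (z ≡ π ⟨$⟩ʳ x)
liftMatching-member {s = s} {π} {x} {y} h = =ᵇ-true (∧-trueˡ {y =ᵇ x ⊕ s} h) , =ᵇ-true (∧-trueʳ {y =ᵇ x ⊕ s} h)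

liftMatching-at : ∀ {n} (s : Fin n) (π : Permutation′ n) x → liftMatching s π (x , x ⊕ s , π ⟨$⟩ʳ x) ≡ true
liftMatching-at s π x = ∧-true (=ᵇ-refl (x ⊕ s)) (=ᵇ-refl (π ⟨$⟩ʳ x))

lift-isPerfectMatching : ∀ {n} (G : Fin n → BipGraph n) (s : Fin n) (π : Permutation′ n) →
  IsMatching (G s) π → IsPerfectMatching (fromSlices G) (liftMatching s π)
lift-isPerfectMatching G s π matching = edges , disjoint , cover₁ , cover₂ , cover₃
  where
  edges : ∀ e → liftMatching s π e ≡ true → fromSlices G e ≡ true
  edges (x , y , z) h with liftMatching-member {s = s} {π} {x} {y} {z} h
  ... | refl , refl rewrite ⊕-⊖-cancelˡ x s = matching x
  disjoint : ∀ e e' → liftMatching s π e ≡ true → liftMatching s π e' ≡ true → e ≢ e' → VertexDisjoint e e'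
  disjoint (x , y , z) (x' , y' , z') h h' e≢e'
    with liftMatching-member {s = s} {π} {x} {y} {z} h | liftMatching-member {s = s} {π} {x'} {y'} {z'} h'
  ... | refl , refl | refl , refl = x≢x' , (λ e → x≢x' (shift-injective e)) , (λ e → x≢x' (π-injective e))
    where
    x≢x' : x ≢ x'
    x≢x' refl = e≢e' refl
    shift-injective : x ⊕ s ≡ x' ⊕ s → x ≡ x'
    shift-injective e = trans (sym (⊕-⊖-cancelʳ x s)) (trans (cong (_⊖ s) e) (⊕-⊖-cancelʳ x' s))
    π-injective : π ⟨$⟩ʳ x ≡ π ⟨$⟩ʳ x' → x ≡ x'
    π-injective e = trans (sym (inverseˡ π)) (trans (cong (π ⟨$⟩ˡ_) e) (inverseˡ π))
  cover₁ : ∀ x → ∃[ b ] ∃[ c ] liftMatching s π (x , b , c) ≡ true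
  cover₁ x = x ⊕ s , π ⟨$⟩ʳ x , liftMatching-at s π x
  cover₂ : ∀ y → ∃[ a ] ∃[ c ] liftMatching s π (a , y , c) ≡ true
  cover₂ y = y ⊖ s , π ⟨$⟩ʳ (y ⊖ s) ,
    subst (λ w → liftMatching s π (y ⊖ s , w , π ⟨$⟩ʳ (y ⊖ s)) ≡ true) (⊖-⊕-cancel y s) (liftMatching-at s π (y ⊖ s))
  cover₃ : ∀ z → ∃[ a ] ∃[ b ] liftMatching s π (a , b , z) ≡ true
  cover₃ z = π ⟨$⟩ˡ z , (π ⟨$⟩ˡ z) ⊕ s ,
    subst (λ w → liftMatching s π (π ⟨$⟩ˡ z , (π ⟨$⟩ˡ z) ⊕ s , w) ≡ true) (inverseʳ π) (liftMatching-at s π (π ⟨$⟩ˡ z))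

-- k disjoint matchings in each of the n slices lift to n·k edge-disjoint perfect matchings:
-- lifts of different slices differ in the middle coordinate of every triple.
lift-disjoint-matchings : ∀ {n k} p q (G : Fin n → BipGraph n) →
  (∀ s → DisjointMatchings (G s) k) → p * (n * n) ≤ q * (n * k) → HasManyDisjointPMs p q n (fromSlices G)
lift-disjoint-matchings {n} {k} p q G matchings enough = n * k , M , enough , perfect , disjoint
  where
  Π : Fin n → Fin k → Permutation′ n
  Π s = proj₁ (matchings s)
  M : Fin (n * k) → TripleSet n
  M i = let (s , j) = remQuot {n} k i in liftMatching s (Π s j)
  perfect : ∀ i → IsPerfectMatching (fromSlices G) (M i)
  perfect i = let (s , j) = remQuot {n} k i in lift-isPerfectMatching G s (Π s j) (proj₁ (proj₂ (matchings s)) j)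
  disjoint : ∀ i i' → i ≢ i' → ∀ e → M i e ≡ true → M i' e ≡ true → ⊥
  disjoint i i' i≢i' (x , y , z) = distinct-indices (remQuot {n} k i) (remQuot {n} k i') refl refl
    where
    distinct-indices : ∀ sj s'j' → remQuot {n} k i ≡ sj → remQuot {n} k i' ≡ s'j' →
      liftMatching (proj₁ sj) (Π (proj₁ sj) (proj₂ sj)) (x , y , z) ≡ true →
      liftMatching (proj₁ s'j') (Π (proj₁ s'j') (proj₂ s'j')) (x , y , z) ≡ true → ⊥
    distinct-indices (s , j) (s' , j') eq eq' h h'
      with liftMatching-member {s = s} {Π s j} {x} {y} {z} h | liftMatching-member {s = s'} {Π s' j'} {x} {y} {z} h'
    ... | y≡x⊕s , z≡πx | y≡x⊕s' , z≡π'x = same-slice (trans (sym (⊕-⊖-cancelˡ x s))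
                                            (trans (cong (_⊖ x) (trans (sym y≡x⊕s) y≡x⊕s')) (⊕-⊖-cancelˡ x s')))
      where
      same-slice : s ≡ s' → ⊥
      same-slice refl with j ≟ j'
      ... | yes refl = i≢i' (trans (sym (Finₚ.combine-remQuot {n} k i))
                         (trans (cong (uncurry combine) (trans eq (sym eq'))) (Finₚ.combine-remQuot {n} k i')))
      ... | no j≢j' = proj₂ (proj₂ (matchings s)) j j' j≢j' x (trans (sym z≡πx) z≡π'x)

private variable
  A B : Set

sumOver : (A → ℕ) → List A → ℕ
sumOver w [] = 0
sumOver w (x ∷ xs) = w x + sumOver w xs

sumOver-cong : {w v : A → ℕ} → (∀ x → w x ≡ v x) → (xs : List A) → sumOver w xs ≡ sumOver v xs
sumOver-cong e [] = refl
sumOver-cong e (x ∷ xs) = cong₂ _+_ (e x) (sumOver-cong e xs)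

sumOver-mono : {w v : A → ℕ} → (∀ x → w x ≤ v x) → (xs : List A) → sumOver w xs ≤ sumOver v xs
sumOver-mono e [] = ≤-refl
sumOver-mono e (x ∷ xs) = +-mono-≤ (e x) (sumOver-mono e xs)

sumOver-++ : (w : A → ℕ) (xs ys : List A) → sumOver w (xs ++ ys) ≡ sumOver w xs + sumOver w ys
sumOver-++ w [] ys = refl
sumOver-++ w (x ∷ xs) ys = trans (cong (w x +_) (sumOver-++ w xs ys)) (sym (+-assoc (w x) _ _))

sumOver-concatMap : (w : B → ℕ) (f : A → List B) (xs : List A) →
  sumOver w (concatMap f xs) ≡ sumOver (λ x → sumOver w (f x)) xs
sumOver-concatMap w f [] = refl
sumOver-concatMap w f (x ∷ xs) = trans (sumOver-++ w (f x) (concatMap f xs)) (cong (sumOver w (f x) +_) (sumOver-concatMap w f xs))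

sumOver-map : (w : B → ℕ) (f : A → B) (xs : List A) → sumOver w (map f xs) ≡ sumOver (w ∘ f) xs
sumOver-map w f [] = refl
sumOver-map w f (x ∷ xs) = cong (w (f x) +_) (sumOver-map w f xs)

sumOver-+ : (u v : A → ℕ) (xs : List A) → sumOver (λ x → u x + v x) xs ≡ sumOver u xs + sumOver v xs
sumOver-+ u v [] = refl
sumOver-+ u v (x ∷ xs) = trans (cong (u x + v x +_) (sumOver-+ u v xs)) (+-interchange (u x) (v x) _ _)

sumOver-*ˡ : (c : ℕ) (w : A → ℕ) (xs : List A) → sumOver (λ x → c * w x) xs ≡ c * sumOver w xs
sumOver-*ˡ c w [] = sym (*-zeroʳ c)
sumOver-*ˡ c w (x ∷ xs) = trans (cong (c * w x +_) (sumOver-*ˡ c w xs)) (sym (*-distribˡ-+ c (w x) _))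

sumOver-*ʳ : (c : ℕ) (w : A → ℕ) (xs : List A) → sumOver (λ x → w x * c) xs ≡ sumOver w xs * c
sumOver-*ʳ c w [] = refl
sumOver-*ʳ c w (x ∷ xs) = trans (cong (w x * c +_) (sumOver-*ʳ c w xs)) (sym (*-distribʳ-+ c (w x) _))

sumOver-const : (c : ℕ) (xs : List A) → sumOver (λ _ → c) xs ≡ length xs * c
sumOver-const c [] = refl
sumOver-const c (x ∷ xs) = cong (c +_) (sumOver-const c xs)

sumOver-swap : (f : B → A → ℕ) (ys : List B) (xs : List A) →
  sumOver (λ x → sumOver (λ y → f y x) ys) xs ≡ sumOver (λ y → sumOver (f y) xs) ys
sumOver-swap f [] xs = trans (sumOver-const 0 xs) (*-zeroʳ (length xs))
sumOver-swap f (y ∷ ys) xs =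
  trans (sumOver-+ (f y) (λ x → sumOver (λ y → f y x) ys) xs) (cong (sumOver (f y) xs +_) (sumOver-swap f ys xs))

sumOver-bound : (f : A → ℕ) (W Y : ℕ) (xs : List A) → All (λ x → f x * W ≤ Y) xs → sumOver f xs * W ≤ length xs * Y
sumOver-bound f W Y [] [] = z≤n
sumOver-bound f W Y (x ∷ xs) (p ∷ ps) =
  subst (_≤ Y + length xs * Y) (sym (*-distribʳ-+ W (f x) (sumOver f xs))) (+-mono-≤ p (sumOver-bound f W Y xs ps))

length-concatMap : (f : A → List B) (c : ℕ) (xs : List A) → (∀ x → length (f x) ≡ c) → length (concatMap f xs) ≡ length xs * c
length-concatMap f c [] h = refl
length-concatMap f c (x ∷ xs) h = trans (Listₚ.length-++ (f x)) (cong₂ _+_ (h x) (length-concatMap f c xs h))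

functions : List A → (n : ℕ) → List (Fin n → A)
functions xs zero = (λ ()) ∷ []
functions xs (suc n) = concatMap (λ x → map (x Vector.∷_) (functions xs n)) xs

sumOver-functions : (xs : List A) (n : ℕ) (w : Fin n → A → ℕ) →
  sumOver (λ f → ∏ (λ i → w i (f i))) (functions xs n) ≡ ∏ (λ i → sumOver (w i) xs)
sumOver-functions xs zero w = refl
sumOver-functions xs (suc n) w = begin
  sumOver F (concatMap (λ x → map (x Vector.∷_) L) xs)   ≡⟨ sumOver-concatMap F _ xs ⟩
  sumOver (λ x → sumOver F (map (x Vector.∷_) L)) xs     ≡⟨ sumOver-cong (λ x → sumOver-map F (x Vector.∷_) L) xs ⟩
  sumOver (λ x → sumOver (λ h → w zero x * R h) L) xs   ≡⟨ sumOver-cong (λ x → sumOver-*ˡ (w zero x) R L) xs ⟩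
  sumOver (λ x → w zero x * sumOver R L) xs              ≡⟨ sumOver-*ʳ (sumOver R L) (w zero) xs ⟩
  sumOver (w zero) xs * sumOver R L                      ≡⟨ cong (sumOver (w zero) xs *_) (sumOver-functions xs n (w ∘ suc)) ⟩
  ∏ (λ i → sumOver (w i) xs) ∎
  where
  open ≡-Reasoning
  L = functions xs n
  F : (Fin (suc n) → _) → ℕ
  F f = ∏ (λ i → w i (f i))
  R : (Fin n → _) → ℕ
  R h = ∏ (λ i → w (suc i) (h i))

length-functions : (xs : List A) (n : ℕ) → length (functions xs n) ≡ length xs ^ n
length-functions xs n = begin
  length (functions xs n)                        ≡⟨ length≡sumOver-1 (functions xs n) ⟩
  sumOver (λ _ → 1) (functions xs n)             ≡⟨ sumOver-cong (λ _ → sym (trans (∏-const {n} 1) (^-zeroˡ n))) (functions xs n) ⟩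
  sumOver (λ f → ∏ {n} (λ i → 1)) (functions xs n) ≡⟨ sumOver-functions xs n (λ _ _ → 1) ⟩
  ∏ {n} (λ _ → sumOver (λ _ → 1) xs)            ≡⟨ ∏-cong {n} (λ _ → sym (length≡sumOver-1 xs)) ⟩
  ∏ {n} (λ _ → length xs)                        ≡⟨ ∏-const {n} (length xs) ⟩
  length xs ^ n ∎
  where
  open ≡-Reasoning
  length≡sumOver-1 : (ys : List B) → length ys ≡ sumOver (λ _ → 1) ys
  length≡sumOver-1 [] = refl
  length≡sumOver-1 (y ∷ ys) = cong suc (length≡sumOver-1 ys)

Differ : ∀ {n} → (A → A → Set) → (Fin n → A) → (Fin n → A) → Set
Differ R f g = ∃[ i ] R (f i) (g i)

functions-distinct : ∀ {R : A → A → Set} (xs : List A) → AllPairs R xs → (n : ℕ) → AllPairs (Differ R) (functions xs n)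
functions-distinct xs distinct zero = [] ∷ []
functions-distinct {R = R} xs distinct (suc n) = blocks xs distinct
  where
  L = functions xs n
  block : ∀ y → List (Fin (suc n) → _)
  block y = map (y Vector.∷_) L
  blocks : ∀ ys → AllPairs R ys → AllPairs (Differ R) (concatMap block ys)
  blocks [] [] = []
  blocks (y ∷ ys) (y-vs-ys ∷ ys-distinct) = AllPairsₚ.++⁺
    (AllPairsₚ.map⁺ (AllPairs.map (λ { (i , r) → suc i , r }) (functions-distinct xs distinct n)))
    (blocks ys ys-distinct)
    (Allₚ.map⁺ (All.universal (λ h → heads-differ h ys y-vs-ys) L))
    where
    heads-differ : ∀ h zs → All (R y) zs → All (Differ R (y Vector.∷ h)) (concatMap block zs)
    heads-differ h [] [] = []
    heads-differ h (z ∷ zs) (r ∷ rs) = Allₚ.++⁺ (Allₚ.map⁺ (All.universal (λ _ → zero , r) L)) (heads-differ h zs rs)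

functions-complete : ∀ {E : A → A → Set} (xs : List A) → (∀ a → Any (E a) xs) → (n : ℕ) →
  ∀ (f : Fin n → A) → Any (λ f' → ∀ i → E (f i) (f' i)) (functions xs n)
functions-complete xs complete zero f = here (λ ())
functions-complete {E = E} xs complete (suc n) f =
  Anyₚ.concatMap⁺ _ (Any.map (λ {y} e → Anyₚ.map⁺ (Any.map (extend e) (functions-complete xs complete n (f ∘ suc)))) (complete (f zero)))
  where
  extend : ∀ {y h} → E (f zero) y → (∀ i → E (f (suc i)) (h i)) → ∀ i → E (f i) ((y Vector.∷ h) i)
  extend e r zero = e
  extend e r (suc i) = r i

-- Counting hypergraphs.  A hypergraph is enumerated as the family of its n slices;
-- everything below counts members of the list allFamilies n of all 2^(n³) families.

countOver : (A → Bool) → List A → ℕ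
countOver p = sumOver (λ x → bit (p x))

length-filterᵇ : (p : A → Bool) (xs : List A) → length (filterᵇ p xs) ≡ countOver p xs
length-filterᵇ p [] = refl
length-filterᵇ p (x ∷ xs) with p x
... | true = cong suc (length-filterᵇ p xs)
... | false = length-filterᵇ p xs

countOver-complement : (p : A → Bool) (xs : List A) → countOver p xs + countOver (not ∘ p) xs ≡ length xs
countOver-complement p [] = refl
countOver-complement p (x ∷ xs) with p x
... | true = cong suc (countOver-complement p xs)
... | false = trans (+-suc (countOver p xs) _) (cong suc (countOver-complement p xs))

markov : (p : A → Bool) (w : A → ℕ) (W : ℕ) → (∀ x → p x ≡ true → W ≤ w x) →
  (xs : List A) → countOver p xs * W ≤ sumOver w xs
markov p w W h [] = z≤n
markov p w W h (x ∷ xs) with p x in eq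
... | true = +-mono-≤ (h x eq) (markov p w W h xs)
... | false = ≤-trans (markov p w W h xs) (m≤n+m _ (w x))

anyOccurs : List B → (B → A → Bool) → A → Bool
anyOccurs [] occurs x = false
anyOccurs (e ∷ es) occurs x = occurs e x ∨ anyOccurs es occurs x

union-bound : (es : List B) (occurs : B → A → Bool) (xs : List A) →
  countOver (anyOccurs es occurs) xs ≤ sumOver (λ e → countOver (occurs e) xs) es
union-bound es occurs xs = subst (countOver (anyOccurs es occurs) xs ≤_)
  (sumOver-swap (λ e x → bit (occurs e x)) es xs) (sumOver-mono (bit-anyOccurs es) xs)
  where
  bit-anyOccurs : ∀ es x → bit (anyOccurs es occurs x) ≤ sumOver (λ e → bit (occurs e x)) es
  bit-anyOccurs [] x = z≤n
  bit-anyOccurs (e ∷ es) x with occurs e x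
  ... | true = s≤s z≤n
  ... | false = bit-anyOccurs es x

anyOccurs-false : (es : List B) (occurs : B → A → Bool) (x : A) →
  anyOccurs es occurs x ≡ false → Any (λ e → occurs e x ≡ true) es → ⊥
anyOccurs-false (e ∷ es) occurs x none (here hit) rewrite hit = true≢false refl none
anyOccurs-false (e ∷ es) occurs x none (there hit) with occurs e x
... | true = true≢false refl none
... | false = anyOccurs-false es occurs x none hit

bools : List Bool
bools = true ∷ false ∷ []

-- A family of n slices, i.e. a hypergraph; the same type also serves for sets of cells
-- (s, a, c), called 3-patterns.
Family : ℕ → Set
Family n = Fin n → BipGraph n

allFamilies : (n : ℕ) → List (Family n)
allFamilies n = functions (functions (functions bools n) n) n

length-allFamilies : (n : ℕ) → length (allFamilies n) ≡ 2 ^ (n * n * n)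
length-allFamilies n = begin
  length (allFamilies n)                              ≡⟨ length-functions _ n ⟩
  length (functions (functions bools n) n) ^ n        ≡⟨ cong (_^ n) (length-functions _ n) ⟩
  (length (functions bools n) ^ n) ^ n                ≡⟨ cong (λ x → (x ^ n) ^ n) (length-functions bools n) ⟩
  ((2 ^ n) ^ n) ^ n                                   ≡⟨ cong (_^ n) (^-*-assoc 2 n n) ⟩
  (2 ^ (n * n)) ^ n                                   ≡⟨ ^-*-assoc 2 (n * n) n ⟩
  2 ^ (n * n * n) ∎
  where open ≡-Reasoning

∑³ : ∀ {n} → (Fin n → Fin n → Fin n → ℕ) → ℕ
∑³ f = ∑ (λ s → ∑ (λ a → ∑ (λ c → f s a c)))

∏³ : ∀ {n} → (Fin n → Fin n → Fin n → ℕ) → ℕ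
∏³ f = ∏ (λ s → ∏ (λ a → ∏ (λ c → f s a c)))

∏³-cong : ∀ {n} {f g : Fin n → Fin n → Fin n → ℕ} → (∀ s a c → f s a c ≡ g s a c) → ∏³ f ≡ ∏³ g
∏³-cong e = ∏-cong (λ s → ∏-cong (λ a → ∏-cong (λ c → e s a c)))

∏³-* : ∀ {n} (f g : Fin n → Fin n → Fin n → ℕ) → ∏³ (λ s a c → f s a c * g s a c) ≡ ∏³ f * ∏³ g
∏³-* f g = trans (∏-cong (λ s → trans (∏-cong (λ a → ∏-* (f s a) (g s a))) (∏-* (λ a → ∏ (f s a)) (λ a → ∏ (g s a)))))
  (∏-* (λ s → ∏ (λ a → ∏ (f s a))) (λ s → ∏ (λ a → ∏ (g s a))))

^-∑³ : ∀ {n} (m : ℕ) (f : Fin n → Fin n → Fin n → ℕ) → m ^ ∑³ f ≡ ∏³ (λ s a c → m ^ f s a c)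
^-∑³ m f = trans (^-∑ m (λ s → ∑ (λ a → ∑ (f s a)))) (∏-cong (λ s → trans (^-∑ m (λ a → ∑ (f s a))) (∏-cong (λ a → ^-∑ m (f s a)))))

∏³-const : ∀ {n} (m : ℕ) → ∏³ {n} (λ _ _ _ → m) ≡ m ^ (n * n * n)
∏³-const {n} m = begin
  ∏³ {n} (λ _ _ _ → m)  ≡⟨ ∏-cong {n} (λ s → trans (∏-cong {n} (λ a → ∏-const {n} m)) (∏-const {n} (m ^ n))) ⟩
  ∏ {n} (λ _ → (m ^ n) ^ n) ≡⟨ ∏-const {n} ((m ^ n) ^ n) ⟩
  ((m ^ n) ^ n) ^ n      ≡⟨ trans (cong (_^ n) (^-*-assoc m n n)) (^-*-assoc m (n * n) n) ⟩
  m ^ (n * n * n) ∎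
  where open ≡-Reasoning

size³ : ∀ {n} → Family n → ℕ
size³ Z = ∑³ (λ s a c → bit (Z s a c))

missing³ : ∀ {n} → Family n → Family n → ℕ
missing³ G Z = ∑³ (λ s a c → bit (Z s a c ∧ not (G s a c)))

cellWeight : Bool → ℕ
cellWeight true = 3
cellWeight false = 2

-- Summing 2^(missing cells of Z) over all hypergraphs: each cell of Z contributes
-- 2⁰ + 2¹ = 3, every other cell 2⁰ + 2⁰ = 2.
sum-weights : ∀ {n} (Z : Family n) →
  sumOver (λ G → 2 ^ missing³ G Z) (allFamilies n) ≡ ∏³ (λ s a c → cellWeight (Z s a c))
sum-weights {n} Z = begin
  sumOver (λ G → 2 ^ missing³ G Z) (allFamilies n)
    ≡⟨ sumOver-cong (λ G → ^-∑³ 2 (λ s a c → bit (Z s a c ∧ not (G s a c)))) (allFamilies n) ⟩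
  sumOver (λ G → ∏ (λ s → w₁ s (G s))) (allFamilies n)    ≡⟨ sumOver-functions _ n w₁ ⟩
  ∏ (λ s → sumOver (w₁ s) (functions (functions bools n) n))
    ≡⟨ ∏-cong (λ s → sumOver-functions _ n (w₂ s)) ⟩
  ∏ (λ s → ∏ (λ a → sumOver (w₂ s a) (functions bools n)))
    ≡⟨ ∏-cong (λ s → ∏-cong (λ a → sumOver-functions bools n (w₃ s a))) ⟩
  ∏³ (λ s a c → sumOver (w₃ s a c) bools)                  ≡⟨ ∏³-cong (λ s a c → two-values (Z s a c)) ⟩
  ∏³ (λ s a c → cellWeight (Z s a c)) ∎
  where
  open ≡-Reasoning
  w₃ : Fin n → Fin n → Fin n → Bool → ℕ
  w₃ s a c b = 2 ^ bit (Z s a c ∧ not b)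
  w₂ : Fin n → Fin n → (Fin n → Bool) → ℕ
  w₂ s a r = ∏ (λ c → w₃ s a c (r c))
  w₁ : Fin n → BipGraph n → ℕ
  w₁ s g = ∏ (λ a → w₂ s a (g a))
  two-values : ∀ z → 2 ^ bit (z ∧ false) + (2 ^ bit (z ∧ true) + 0) ≡ cellWeight z
  two-values true = refl
  two-values false = refl

weight-identity : ∀ {n} (Z : Family n) →
  2 ^ size³ Z * sumOver (λ G → 2 ^ missing³ G Z) (allFamilies n) ≡ 2 ^ (n * n * n) * 3 ^ size³ Z
weight-identity {n} Z = begin
  2 ^ size³ Z * sumOver (λ G → 2 ^ missing³ G Z) (allFamilies n)
    ≡⟨ cong₂ _*_ (^-∑³ 2 (λ s a c → bit (Z s a c))) (sum-weights Z) ⟩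
  ∏³ (λ s a c → 2 ^ bit (Z s a c)) * ∏³ (λ s a c → cellWeight (Z s a c))
    ≡⟨ ∏³-* (λ s a c → 2 ^ bit (Z s a c)) (λ s a c → cellWeight (Z s a c)) ⟨
  ∏³ (λ s a c → 2 ^ bit (Z s a c) * cellWeight (Z s a c))  ≡⟨ ∏³-cong (λ s a c → per-cell (Z s a c)) ⟩
  ∏³ {n} (λ s a c → 2 * 3 ^ bit (Z s a c))                 ≡⟨ ∏³-* {n} (λ _ _ _ → 2) (λ s a c → 3 ^ bit (Z s a c)) ⟩
  ∏³ {n} (λ _ _ _ → 2) * ∏³ (λ s a c → 3 ^ bit (Z s a c))
    ≡⟨ cong₂ _*_ (∏³-const {n} 2) (sym (^-∑³ 3 (λ s a c → bit (Z s a c)))) ⟩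
  2 ^ (n * n * n) * 3 ^ size³ Z ∎
  where
  open ≡-Reasoning
  per-cell : ∀ z → 2 ^ bit z * cellWeight z ≡ 2 * 3 ^ bit z
  per-cell true = refl
  per-cell false = refl

edgesIn : ∀ {n} → BipGraph n → BipGraph n → ℕ
edgesIn g Z = ∑ (λ a → count (λ c → Z a c ∧ g a c))

missing : ∀ {n} → BipGraph n → BipGraph n → ℕ
missing g Z = ∑ (λ a → count (λ c → Z a c ∧ not (g a c)))

size : ∀ {n} → BipGraph n → ℕ
size Z = ∑ (λ a → count (Z a))

edgesIn+missing : ∀ {n} (g Z : BipGraph n) → edgesIn g Z + missing g Z ≡ size Z
edgesIn+missing g Z = trans (sym (∑-+ (λ a → count (λ c → Z a c ∧ g a c)) (λ a → count (λ c → Z a c ∧ not (g a c)))))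
  (∑-cong (λ a → count-split (Z a) (g a)))

onSlice : ∀ {n} → Fin n → BipGraph n → Family n
onSlice s Z s' a c = (s' =ᵇ s) ∧ Z a c

∑³-onSlice : ∀ {n} (s : Fin n) (h : Family n) →
  ∑ (λ s' → ∑ (λ a → count (λ c → (s' =ᵇ s) ∧ h s' a c))) ≡ ∑ (λ a → count (h s a))
∑³-onSlice s h = trans (∑-cong (λ s' → trans (∑-cong (λ a → count-∧ˡ (s' =ᵇ s) (h s' a))) (∑-*ˡ (bit (s' =ᵇ s)) (λ a → count (h s' a)))))
  (∑-δ s (λ s' → ∑ (λ a → count (h s' a))))

missing³-onSlice : ∀ {n} (G : Family n) (s : Fin n) (Z : BipGraph n) → missing³ G (onSlice s Z) ≡ missing (G s) Z
missing³-onSlice G s Z = trans (∑-cong (λ s' → ∑-cong (λ a → count-cong (λ c → Boolₚ.∧-assoc (s' =ᵇ s) (Z a c) (not (G s' a c))))))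
  (∑³-onSlice s (λ s' a c → Z a c ∧ not (G s' a c)))

size³-onSlice : ∀ {n} (s : Fin n) (Z : BipGraph n) → size³ (onSlice s Z) ≡ size Z
size³-onSlice s Z = ∑³-onSlice s (λ _ a c → Z a c)

record Event (n : ℕ) : Set where
  constructor event
  field
    slice : Fin n
    cells : BipGraph n
    threshold : ℕ
    active : Bool
open Event

occurs : ∀ {n} → Event n → Family n → Bool
occurs E G = active E ∧ (edgesIn (G (slice E)) (cells E) <ᵇ threshold E)

<ᵇ-true : ∀ {m n} → (m <ᵇ n) ≡ true → m < n
<ᵇ-true {m} {n} e = <ᵇ⇒< m n (subst T (sym e) tt)

<ᵇ-false : ∀ {m n} → (m <ᵇ n) ≡ false → n ≤ m
<ᵇ-false e = ≮⇒≥ (λ lt → subst T e (<⇒<ᵇ lt))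

≤ᵇ-true : ∀ {m n} → (m ≤ᵇ n) ≡ true → m ≤ n
≤ᵇ-true {m} {n} e = ≤ᵇ⇒≤ m n (subst T (sym e) tt)

≤ᵇ-intro : ∀ {m n} → m ≤ n → (m ≤ᵇ n) ≡ true
≤ᵇ-intro {m} {n} le with m ≤ᵇ n in eq
... | true = refl
... | false = ⊥-elim (subst T eq (≤⇒≤ᵇ le))

*-^-distrib : ∀ a b n → (a * b) ^ n ≡ a ^ n * b ^ n
*-^-distrib a b n = trans (sym (∏-const {n} (a * b))) (trans (∏-* {n} (λ _ → a) (λ _ → b)) (cong₂ _*_ (∏-const {n} a) (∏-const {n} b)))

-- Such hypergraphs miss at least
-- σ + 1 - L cells of the pattern, so Markov's inequality for the weight 2^(missing cells)
-- and the weight identity give the bound.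
chernoff : ∀ {n} (s : Fin n) (Z : BipGraph n) (L : ℕ) →
  countOver (occurs (event s Z L true)) (allFamilies n) * 2 * 4 ^ size Z ≤ 2 ^ L * 2 ^ (n * n * n) * 3 ^ size Z
chernoff {n} s Z L = begin
  C * 2 * 4 ^ σ                          ≡⟨ cong (C * 2 *_) (*-^-distrib 2 2 σ) ⟩
  C * 2 * (2 ^ σ * 2 ^ σ)                ≡⟨ *-assoc C 2 (2 ^ σ * 2 ^ σ) ⟩
  C * (2 * (2 ^ σ * 2 ^ σ))              ≡⟨ cong (C *_) (*-assoc 2 (2 ^ σ) (2 ^ σ)) ⟨
  C * (2 ^ suc σ * 2 ^ σ)                ≡⟨ *-assoc C (2 ^ suc σ) (2 ^ σ) ⟨
  C * 2 ^ suc σ * 2 ^ σ                  ≤⟨ *-monoˡ-≤ (2 ^ σ) (markov (occurs E) (λ G → 2 ^ L * 2 ^ missing³ G Z³) (2 ^ suc σ) heavy (allFamilies n)) ⟩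
  sumOver (λ G → 2 ^ L * 2 ^ missing³ G Z³) (allFamilies n) * 2 ^ σ
                                          ≡⟨ cong (_* 2 ^ σ) (sumOver-*ˡ (2 ^ L) (λ G → 2 ^ missing³ G Z³) (allFamilies n)) ⟩
  2 ^ L * W * 2 ^ σ                      ≡⟨ *-assoc (2 ^ L) W (2 ^ σ) ⟩
  2 ^ L * (W * 2 ^ σ)                    ≡⟨ cong (2 ^ L *_) (*-comm W (2 ^ σ)) ⟩
  2 ^ L * (2 ^ σ * W)                    ≡⟨ cong (2 ^ L *_) (subst (λ x → 2 ^ x * W ≡ 2 ^ (n * n * n) * 3 ^ x) (size³-onSlice s Z) (weight-identity Z³)) ⟩
  2 ^ L * (2 ^ (n * n * n) * 3 ^ σ)      ≡⟨ *-assoc (2 ^ L) (2 ^ (n * n * n)) (3 ^ σ) ⟨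
  2 ^ L * 2 ^ (n * n * n) * 3 ^ σ ∎
  where
  open ≤-Reasoning
  E = event s Z L true
  Z³ = onSlice s Z
  σ = size Z
  C = countOver (occurs E) (allFamilies n)
  W = sumOver (λ G → 2 ^ missing³ G Z³) (allFamilies n)
  heavy : ∀ G → occurs E G ≡ true → 2 ^ suc σ ≤ 2 ^ L * 2 ^ missing³ G Z³
  heavy G few-edges = subst (2 ^ suc σ ≤_)
    (trans (^-distribˡ-+-* 2 L (missing (G s) Z)) (cong (λ x → 2 ^ L * 2 ^ x) (sym (missing³-onSlice G s Z))))
    (^-monoʳ-≤ 2 (subst (λ x → suc x ≤ L + missing (G s) Z) (edgesIn+missing (G s) Z)
      (+-monoˡ-≤ (missing (G s) Z) (<ᵇ-true few-edges))))

shrink-exponent : ∀ x Y {σ₀ σ} → σ₀ ≤ σ → x * 4 ^ σ ≤ Y * 3 ^ σ → x * 4 ^ σ₀ ≤ Y * 3 ^ σ₀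
shrink-exponent x Y {σ₀} {σ} σ₀≤σ bound = *-cancelʳ-≤ _ _ (4 ^ d) {{>-nonZero (m^n>0 4 d)}} (begin
  x * 4 ^ σ₀ * 4 ^ d      ≡⟨ *-assoc x (4 ^ σ₀) (4 ^ d) ⟩
  x * (4 ^ σ₀ * 4 ^ d)    ≡⟨ cong (x *_) (^-distribˡ-+-* 4 σ₀ d) ⟨
  x * 4 ^ (σ₀ + d)        ≡⟨ cong (λ e → x * 4 ^ e) σ₀+d≡σ ⟩
  x * 4 ^ σ               ≤⟨ bound ⟩
  Y * 3 ^ σ               ≡⟨ cong (λ e → Y * 3 ^ e) σ₀+d≡σ ⟨
  Y * 3 ^ (σ₀ + d)        ≡⟨ cong (Y *_) (^-distribˡ-+-* 3 σ₀ d) ⟩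
  Y * (3 ^ σ₀ * 3 ^ d)    ≤⟨ *-monoʳ-≤ Y (*-monoʳ-≤ (3 ^ σ₀) (^-monoˡ-≤ d (≤ᵇ⇒≤ 3 4 tt))) ⟩
  Y * (3 ^ σ₀ * 4 ^ d)    ≡⟨ *-assoc Y (3 ^ σ₀) (4 ^ d) ⟨
  Y * 3 ^ σ₀ * 4 ^ d ∎)
  where
  open ≤-Reasoning
  d = σ ∸ σ₀
  σ₀+d≡σ : σ₀ + d ≡ σ
  σ₀+d≡σ = m+[n∸m]≡n σ₀≤σ

event-bound : ∀ {n} (E : Event n) (σ₀ : ℕ) → (active E ≡ true → σ₀ ≤ size (cells E)) →
  countOver (occurs E) (allFamilies n) * (2 * 4 ^ σ₀) ≤ 2 ^ threshold E * 2 ^ (n * n * n) * 3 ^ σ₀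
event-bound {n} (event s Z L false) σ₀ _ =
  subst (λ x → x * (2 * 4 ^ σ₀) ≤ 2 ^ L * 2 ^ (n * n * n) * 3 ^ σ₀) (sym (never (allFamilies n))) z≤n
  where
  never : ∀ Gs → countOver (occurs (event s Z L false)) Gs ≡ 0
  never [] = refl
  never (G ∷ Gs) = never Gs
event-bound {n} (event s Z L true) σ₀ large =
  subst (_≤ 2 ^ L * 2 ^ (n * n * n) * 3 ^ σ₀) (*-assoc C 2 (4 ^ σ₀)) (shrink-exponent (C * 2) (2 ^ L * 2 ^ (n * n * n)) (large refl) (chernoff s Z L))
  where
  C = countOver (occurs (event s Z L true)) (allFamilies n)

rowCells : ∀ {n} → Fin n → BipGraph n
rowCells a a' c = a' =ᵇ a

colCells : ∀ {n} → Fin n → BipGraph n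
colCells c a c' = c' =ᵇ c

boxCells : ∀ {n} → (Fin n → Bool) → (Fin n → Bool) → BipGraph n
boxCells A B a c = A a ∧ B c

edgesIn-row : ∀ {n} (g : BipGraph n) (a : Fin n) → edgesIn g (rowCells a) ≡ rowDeg g a
edgesIn-row g a = trans (∑-cong (λ a' → count-∧ˡ (a' =ᵇ a) (g a'))) (∑-δ a (λ a' → count (g a')))

edgesIn-col : ∀ {n} (g : BipGraph n) (c : Fin n) → edgesIn g (colCells c) ≡ colDeg g c
edgesIn-col g c = ∑-cong (λ a → count-δ c (g a))

size-row : ∀ {n} (a : Fin n) → size (rowCells a) ≡ n
size-row {n} a = trans (∑-cong (λ a' → trans (∑-const {n} (bit (a' =ᵇ a))) (*-comm n (bit (a' =ᵇ a))))) (∑-δ a (λ _ → n))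

size-col : ∀ {n} (c : Fin n) → size (colCells {n} c) ≡ n
size-col {n} c = trans (∑-cong {n} {g = λ _ → 1} (λ _ → count-singleton c)) (trans (∑-const {n} 1) (*-identityʳ n))

size-box : ∀ {n} (A B : Fin n → Bool) → size (boxCells A B) ≡ count A * count B
size-box A B = begin
  ∑ (λ a → count (λ c → A a ∧ B c))  ≡⟨ ∑-cong (λ a → trans (count-∧ˡ (A a) B) (*-comm (bit (A a)) (count B))) ⟩
  ∑ (λ a → count B * bit (A a))       ≡⟨ ∑-*ˡ (count B) (λ a → bit (A a)) ⟩
  count B * count A                   ≡⟨ *-comm (count B) (count A) ⟩
  count A * count B ∎
  where open ≡-Reasoning

subsets : (n : ℕ) → List (Fin n → Bool)
subsets n = functions bools n

subsets-complete : ∀ {n} (A : Fin n → Bool) → Any (λ A' → ∀ i → A i ≡ A' i) (subsets n)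
subsets-complete {n} = functions-complete {E = _≡_} bools (λ { true → here refl ; false → there (here refl) }) n

grid : {X Y Z : Set} → (X → Y → Z) → List X → List Y → List Z
grid f xs ys = concatMap (λ x → map (f x) ys) xs

any-grid : {X Y Z : Set} {P : Z → Set} {Rx : X → Set} {Ry : Y → Set} (f : X → Y → Z) → ∀ {xs ys} →
  Any Rx xs → Any Ry ys → (∀ {x y} → Rx x → Ry y → P (f x y)) → Any P (grid f xs ys)
any-grid f hx hy h = Anyₚ.concatMap⁺ _ (Any.map (λ rx → Anyₚ.map⁺ (Any.map (h rx) hy)) hx)

all-grid : {X Y Z : Set} {P : Z → Set} (f : X → Y → Z) (xs : List X) (ys : List Y) →
  (∀ x y → P (f x y)) → All P (grid f xs ys)
all-grid f xs ys h = Allₚ.concat⁺ (Allₚ.map⁺ (All.universal (λ x → Allₚ.map⁺ (All.universal (h x) ys)) xs))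

length-grid : {X Y Z : Set} (f : X → Y → Z) (xs : List X) (ys : List Y) → length (grid f xs ys) ≡ length xs * length ys
length-grid f xs ys = length-concatMap _ (length ys) xs (λ x → Listₚ.length-map (f x) ys)

module Events (n D k : ℕ) where

  rowEvents colEvents : List (Event n)
  rowEvents = grid (λ s a → event s (rowCells a) (k + D) true) (allFin n) (allFin n)
  colEvents = grid (λ s c → event s (colCells c) (k + D) true) (allFin n) (allFin n)

  boxEvents : List (Event n)
  boxEvents = concatMap (λ s → grid (λ A B → event s (boxCells A B) (k * n + suc n) ((D ≤ᵇ count A) ∧ (D ≤ᵇ count B)))
                                       (subsets n) (subsets n)) (allFin n)

  badEvents : List (Event n)
  badEvents = rowEvents ++ (colEvents ++ boxEvents)

  typical : Family n → Bool
  typical G = not (anyOccurs badEvents occurs G)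

  typical-wellConnected : ∀ G → typical G ≡ true → ∀ s → WellConnected (G s) D (k + D) (k * n + suc n)
  typical-wellConnected G is-typical s = rows , cols , boxes
    where
    never : Any (λ E → occurs E G ≡ true) badEvents → ⊥
    never = anyOccurs-false badEvents occurs G (not-true is-typical)
    rows : ∀ a → k + D ≤ rowDeg (G s) a
    rows a with rowDeg (G s) a <ᵇ k + D in low
    ... | false = <ᵇ-false low
    ... | true = ⊥-elim (never (Anyₚ.++⁺ˡ (any-grid _ (∈-allFin s) (∈-allFin a)
                   λ { refl refl → subst (λ x → (x <ᵇ k + D) ≡ true) (sym (edgesIn-row (G s) a)) low })))
    cols : ∀ c → k + D ≤ colDeg (G s) c
    cols c with colDeg (G s) c <ᵇ k + D in low
    ... | false = <ᵇ-false low
    ... | true = ⊥-elim (never (Anyₚ.++⁺ʳ rowEvents (Anyₚ.++⁺ˡ (any-grid _ (∈-allFin s) (∈-allFin c)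
                   λ { refl refl → subst (λ x → (x <ᵇ k + D) ≡ true) (sym (edgesIn-col (G s) c)) low }))))
    boxes : ∀ A B → D ≤ count A → D ≤ count B → k * n + suc n ≤ edgesBetween (G s) A B
    boxes A B |A| |B| with edgesBetween (G s) A B <ᵇ k * n + suc n in low
    ... | false = <ᵇ-false low
    ... | true = ⊥-elim (never (Anyₚ.++⁺ʳ rowEvents (Anyₚ.++⁺ʳ colEvents
                   (Anyₚ.concatMap⁺ _ (Any.map (λ { refl → any-grid _ (subsets-complete A) (subsets-complete B) box-occurs }) (∈-allFin s))))))
      where
      box-occurs : ∀ {A' B'} → (∀ i → A i ≡ A' i) → (∀ i → B i ≡ B' i) →
        occurs (event s (boxCells A' B') (k * n + suc n) ((D ≤ᵇ count A') ∧ (D ≤ᵇ count B'))) G ≡ true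
      box-occurs {A'} {B'} A≗A' B≗B' = ∧-true
        (∧-true (≤ᵇ-intro (subst (D ≤_) (count-cong A≗A') |A|)) (≤ᵇ-intro (subst (D ≤_) (count-cong B≗B') |B|)))
        (subst (λ x → (x <ᵇ k * n + suc n) ≡ true)
          (∑-cong (λ a → count-cong (λ c → cong₂ (λ u v → (u ∧ v) ∧ G s a c) (A≗A' a) (B≗B' c)))) low)

  N = n * n * n

  frequency : Event n → ℕ
  frequency E = countOver (occurs E) (allFamilies n)

  length-allFin : length (allFin n) ≡ n
  length-allFin = Listₚ.length-tabulate (λ i → i)

  row-frequencies : sumOver frequency rowEvents * (2 * 4 ^ n) ≤ n * n * (2 ^ (k + D) * 2 ^ N * 3 ^ n)
  row-frequencies = subst (λ ℓ → sumOver frequency rowEvents * (2 * 4 ^ n) ≤ ℓ * (2 ^ (k + D) * 2 ^ N * 3 ^ n))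
    (trans (length-grid _ (allFin n) (allFin n)) (cong₂ _*_ length-allFin length-allFin))
    (sumOver-bound frequency _ _ rowEvents (all-grid _ (allFin n) (allFin n)
      λ s a → event-bound (event s (rowCells a) (k + D) true) n (λ _ → ≤-reflexive (sym (size-row a)))))

  col-frequencies : sumOver frequency colEvents * (2 * 4 ^ n) ≤ n * n * (2 ^ (k + D) * 2 ^ N * 3 ^ n)
  col-frequencies = subst (λ ℓ → sumOver frequency colEvents * (2 * 4 ^ n) ≤ ℓ * (2 ^ (k + D) * 2 ^ N * 3 ^ n))
    (trans (length-grid _ (allFin n) (allFin n)) (cong₂ _*_ length-allFin length-allFin))
    (sumOver-bound frequency _ _ colEvents (all-grid _ (allFin n) (allFin n)
      λ s c → event-bound (event s (colCells c) (k + D) true) n (λ _ → ≤-reflexive (sym (size-col c)))))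

  box-frequencies : sumOver frequency boxEvents * (2 * 4 ^ (D * D)) ≤
                    n * (2 ^ n * 2 ^ n) * (2 ^ (k * n + suc n) * 2 ^ N * 3 ^ (D * D))
  box-frequencies = subst (λ ℓ → sumOver frequency boxEvents * (2 * 4 ^ (D * D)) ≤ ℓ * (2 ^ (k * n + suc n) * 2 ^ N * 3 ^ (D * D)))
    (trans (length-concatMap _ (2 ^ n * 2 ^ n) (allFin n)
      (λ s → trans (length-grid _ (subsets n) (subsets n)) (cong₂ _*_ (length-functions bools n) (length-functions bools n))))
      (cong (_* (2 ^ n * 2 ^ n)) length-allFin))
    (sumOver-bound frequency _ _ boxEvents (Allₚ.concat⁺ (Allₚ.map⁺ (All.universal (λ s → all-grid _ (subsets n) (subsets n)
      λ A B → event-bound (event s (boxCells A B) (k * n + suc n) ((D ≤ᵇ count A) ∧ (D ≤ᵇ count B))) (D * D)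
        (λ large → subst (D * D ≤_) (sym (size-box A B))
          (*-mono-≤ {D} {count A} {D} {count B} (≤ᵇ-true (∧-trueˡ {D ≤ᵇ count A} large)) (≤ᵇ-true (∧-trueʳ {D ≤ᵇ count A} large))))) (allFin n)))))

  atypical-split : countOver (not ∘ typical) (allFamilies n) ≤
                   sumOver frequency rowEvents + sumOver frequency colEvents + sumOver frequency boxEvents
  atypical-split = begin
    countOver (not ∘ typical) (allFamilies n)
      ≡⟨ sumOver-cong (λ G → cong bit (Boolₚ.not-involutive (anyOccurs badEvents occurs G))) (allFamilies n) ⟩
    countOver (anyOccurs badEvents occurs) (allFamilies n)  ≤⟨ union-bound badEvents occurs (allFamilies n) ⟩
    sumOver frequency (rowEvents ++ (colEvents ++ boxEvents))
      ≡⟨ trans (sumOver-++ frequency rowEvents _) (cong (sumOver frequency rowEvents +_) (sumOver-++ frequency colEvents _)) ⟩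
    sumOver frequency rowEvents + (sumOver frequency colEvents + sumOver frequency boxEvents)
      ≡⟨ +-assoc (sumOver frequency rowEvents) _ _ ⟨
    sumOver frequency rowEvents + sumOver frequency colEvents + sumOver frequency boxEvents ∎
    where open ≤-Reasoning

-- Elementary estimates for k = t, D = 10t and 32t ≤ n ≤ 32t + 31, t large.

open +-*-Solver

n<2^n : ∀ t → t < 2 ^ t
n<2^n zero = s≤s z≤n
n<2^n (suc t) = subst (suc (suc t) ≤_) (cong (2 ^ t +_) (sym (+-identityʳ (2 ^ t))))
  (+-mono-≤ (≤-trans (s≤s z≤n) (n<2^n t)) (n<2^n t))

square≤2^ : ∀ u → (u + 7) * (u + 7) ≤ 2 ^ (u + 6)
square≤2^ zero = ≤ᵇ⇒≤ 49 64 tt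
square≤2^ (suc u) = subst (λ x → x * x ≤ 2 ^ (suc u + 6)) (+-suc u 7)
  (≤-trans (subst ((u + 8) * (u + 8) ≤_) (doubling u) (m≤m+n _ _)) (*-monoʳ-≤ 2 (square≤2^ u)))
  where
  doubling : ∀ u → (u + 8) * (u + 8) + (u * u + 12 * u + 34) ≡ 2 * ((u + 7) * (u + 7))
  doubling = solve 1 (λ u → (u :+ con 8) :* (u :+ con 8) :+ (u :* u :+ con 12 :* u :+ con 34) := con 2 :* ((u :+ con 7) :* (u :+ con 7))) refl

poly≤4^ : ∀ c t → c + 6 ≤ t → c * (suc t * suc t) ≤ 4 ^ t
poly≤4^ c t c+6≤t = subst (c * (suc t * suc t) ≤_) (sym (*-^-distrib 2 2 t)) (*-mono-≤ c≤2^t square≤2^t)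
  where
  c≤2^t : c ≤ 2 ^ t
  c≤2^t = ≤-trans (m≤m+n c 6) (≤-trans c+6≤t (<⇒≤ (n<2^n t)))
  u = t ∸ 6
  u+6≡t : u + 6 ≡ t
  u+6≡t = m∸n+n≡m (≤-trans (m≤n+m 6 c) c+6≤t)
  square≤2^t : suc t * suc t ≤ 2 ^ t
  square≤2^t = subst (λ x → suc x * suc x ≤ 2 ^ x) u+6≡t
    (subst (_≤ 2 ^ (u + 6)) (cong (λ x → x * x) (trans (+-comm u 7) (cong suc (+-comm 6 u)))) (square≤2^ u))

n²-bound : ∀ t n → n ≤ 32 * t + 31 → n * n ≤ 1024 * (suc t * suc t)
n²-bound t n n≤ = ≤-trans (*-mono-≤ n≤32[t+1] n≤32[t+1]) (≤-reflexive (square t))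
  where
  n≤32[t+1] : n ≤ 32 * suc t
  n≤32[t+1] = ≤-trans n≤ (≤-trans (m≤m+n (32 * t + 31) 1)
    (≤-reflexive (solve 1 (λ t → con 32 :* t :+ con 31 :+ con 1 := con 32 :* (con 1 :+ t)) refl t)))
  square : ∀ t → 32 * suc t * (32 * suc t) ≡ 1024 * (suc t * suc t)
  square = solve 1 (λ t → con 32 :* (con 1 :+ t) :* (con 32 :* (con 1 :+ t)) := con 1024 :* ((con 1 :+ t) :* (con 1 :+ t))) refl

-- 2^(13t) · 3^n ≤ 4^n when 32t ≤ n, from 2¹³ · 3³² ≤ 4³².
2^13t·3^n≤4^n : ∀ t n → 32 * t ≤ n → 2 ^ (13 * t) * 3 ^ n ≤ 4 ^ n
2^13t·3^n≤4^n t n 32t≤n = begin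
  2 ^ (13 * t) * 3 ^ n                      ≡⟨ cong (λ x → 2 ^ (13 * t) * 3 ^ x) (sym n≡32t+ρ) ⟩
  2 ^ (13 * t) * 3 ^ (32 * t + ρ)           ≡⟨ cong (2 ^ (13 * t) *_) (^-distribˡ-+-* 3 (32 * t) ρ) ⟩
  2 ^ (13 * t) * (3 ^ (32 * t) * 3 ^ ρ)     ≡⟨ *-assoc (2 ^ (13 * t)) _ _ ⟨
  2 ^ (13 * t) * 3 ^ (32 * t) * 3 ^ ρ       ≡⟨ cong₂ (λ x y → x * y * 3 ^ ρ) (sym (^-*-assoc 2 13 t)) (sym (^-*-assoc 3 32 t)) ⟩
  (2 ^ 13) ^ t * (3 ^ 32) ^ t * 3 ^ ρ       ≡⟨ cong (_* 3 ^ ρ) (*-^-distrib (2 ^ 13) (3 ^ 32) t) ⟨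
  (2 ^ 13 * 3 ^ 32) ^ t * 3 ^ ρ             ≤⟨ *-mono-≤ (^-monoˡ-≤ t (≤ᵇ⇒≤ (2 ^ 13 * 3 ^ 32) (4 ^ 32) tt)) (^-monoˡ-≤ ρ (≤ᵇ⇒≤ 3 4 tt)) ⟩
  (4 ^ 32) ^ t * 4 ^ ρ                      ≡⟨ cong (_* 4 ^ ρ) (^-*-assoc 4 32 t) ⟩
  4 ^ (32 * t) * 4 ^ ρ                      ≡⟨ ^-distribˡ-+-* 4 (32 * t) ρ ⟨
  4 ^ (32 * t + ρ)                          ≡⟨ cong (4 ^_) n≡32t+ρ ⟩
  4 ^ n ∎
  where
  open ≤-Reasoning
  ρ = n ∸ 32 * t
  n≡32t+ρ : 32 * t + ρ ≡ n
  n≡32t+ρ = m+[n∸m]≡n 32t≤n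

degree-events-rare : ∀ m t n → 4096 * suc m + 6 ≤ t → 32 * t ≤ n → n ≤ 32 * t + 31 →
  (2 * suc m) * (2 * (n * n) * 2 ^ (t + 10 * t) * 3 ^ n) ≤ 2 * 4 ^ n
degree-events-rare m t n large 32t≤n n≤ = begin
  (2 * suc m) * (2 * (n * n) * 2 ^ (t + 10 * t) * 3 ^ n)
    ≡⟨ regroup (suc m) (n * n) (2 ^ (t + 10 * t)) (3 ^ n) ⟩
  2 * (2 * suc m * (n * n) * 2 ^ (t + 10 * t) * 3 ^ n)
    ≤⟨ *-monoʳ-≤ 2 (*-monoˡ-≤ (3 ^ n) (*-monoˡ-≤ (2 ^ (t + 10 * t)) polynomial≤4^t)) ⟩
  2 * (4 ^ t * 2 ^ (t + 10 * t) * 3 ^ n)  ≡⟨ cong (λ x → 2 * (x * 3 ^ n)) 4^t·2^11t≡2^13t ⟩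
  2 * (2 ^ (13 * t) * 3 ^ n)              ≤⟨ *-monoʳ-≤ 2 (2^13t·3^n≤4^n t n 32t≤n) ⟩
  2 * 4 ^ n ∎
  where
  open ≤-Reasoning
  regroup : ∀ a b c d → (2 * a) * (2 * b * c * d) ≡ 2 * (2 * a * b * c * d)
  regroup = solve 4 (λ a b c d → (con 2 :* a) :* (con 2 :* b :* c :* d) := con 2 :* (con 2 :* a :* b :* c :* d)) refl
  polynomial≤4^t : 2 * suc m * (n * n) ≤ 4 ^ t
  polynomial≤4^t = begin
    2 * suc m * (n * n)                  ≤⟨ *-monoˡ-≤ (n * n) (*-monoˡ-≤ (suc m) (≤ᵇ⇒≤ 2 4 tt)) ⟩
    4 * suc m * (n * n)                  ≤⟨ *-monoʳ-≤ (4 * suc m) (n²-bound t n n≤) ⟩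
    4 * suc m * (1024 * (suc t * suc t)) ≡⟨ solve 2 (λ a s → con 4 :* a :* (con 1024 :* s) := con 4096 :* a :* s) refl (suc m) (suc t * suc t) ⟩
    4096 * suc m * (suc t * suc t)       ≤⟨ poly≤4^ (4096 * suc m) t large ⟩
    4 ^ t ∎
  4^t·2^11t≡2^13t : 4 ^ t * 2 ^ (t + 10 * t) ≡ 2 ^ (13 * t)
  4^t·2^11t≡2^13t = begin-equality
    4 ^ t * 2 ^ (t + 10 * t)               ≡⟨ cong (_* 2 ^ (t + 10 * t)) (trans (*-^-distrib 2 2 t) (sym (^-distribˡ-+-* 2 t t))) ⟩
    2 ^ (t + t) * 2 ^ (t + 10 * t)         ≡⟨ ^-distribˡ-+-* 2 (t + t) (t + 10 * t) ⟨
    2 ^ (t + t + (t + 10 * t))             ≡⟨ cong (2 ^_) (solve 1 (λ t → t :+ t :+ (t :+ con 10 :* t) := con 13 :* t) refl t) ⟩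
    2 ^ (13 * t) ∎

box-exponent : ∀ t n → 32 ≤ t → n ≤ 32 * t + 31 → 2 * t + (n + n + (t * n + suc n)) ≤ 40 * (t * t)
box-exponent t n 32≤t n≤ = begin
  2 * t + (n + n + (t * n + suc n))   ≡⟨ solve 2 (λ t n → con 2 :* t :+ (n :+ n :+ (t :* n :+ (con 1 :+ n))) := con 2 :* t :+ con 1 :+ (t :+ con 3) :* n) refl t n ⟩
  2 * t + 1 + (t + 3) * n             ≤⟨ +-monoʳ-≤ (2 * t + 1) (*-monoʳ-≤ (t + 3) n≤) ⟩
  2 * t + 1 + (t + 3) * (32 * t + 31) ≡⟨ solve 1 (λ t → con 2 :* t :+ con 1 :+ (t :+ con 3) :* (con 32 :* t :+ con 31) := con 32 :* (t :* t) :+ (con 129 :* t :+ con 94)) refl t ⟩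
  32 * (t * t) + (129 * t + 94)       ≤⟨ +-monoʳ-≤ (32 * (t * t)) linear≤ ⟩
  32 * (t * t) + 8 * (t * t)          ≡⟨ solve 1 (λ t → con 32 :* (t :* t) :+ con 8 :* (t :* t) := con 40 :* (t :* t)) refl t ⟩
  40 * (t * t) ∎
  where
  open ≤-Reasoning
  linear≤ : 129 * t + 94 ≤ 8 * (t * t)
  linear≤ = begin
    129 * t + 94          ≤⟨ +-monoʳ-≤ (129 * t) (≤-trans (≤ᵇ⇒≤ 94 (127 * 32) tt) (*-monoʳ-≤ 127 32≤t)) ⟩
    129 * t + 127 * t     ≡⟨ solve 1 (λ t → con 129 :* t :+ con 127 :* t := con 8 :* (con 32 :* t)) refl t ⟩
    8 * (32 * t)          ≤⟨ *-monoʳ-≤ 8 (*-monoˡ-≤ t 32≤t) ⟩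
    8 * (t * t) ∎

-- The box events together are rare: 2(m+1) · n·4ⁿ · 2^(kn+n+1) · 3^(D²) ≤ 2 · 4^(D²);
-- here 4^(D²) = 4^(100t²) beats the 2^O(t²) factors, using 3⁵ · 4 ≤ 4⁵.
box-events-rare : ∀ m t n → 4096 * suc m + 6 ≤ t → 32 ≤ t → n ≤ 32 * t + 31 →
  (2 * suc m) * (n * (2 ^ n * 2 ^ n) * 2 ^ (t * n + suc n) * 3 ^ (10 * t * (10 * t))) ≤ 2 * 4 ^ (10 * t * (10 * t))
box-events-rare m t n large 32≤t n≤ = begin
  (2 * suc m) * (n * (2 ^ n * 2 ^ n) * 2 ^ (t * n + suc n) * 3 ^ D²)
    ≡⟨ regroup (suc m) n (2 ^ n) (2 ^ (t * n + suc n)) (3 ^ D²) ⟩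
  2 * (suc m * n * (2 ^ n * 2 ^ n * 2 ^ (t * n + suc n)) * 3 ^ D²)  ≡⟨ cong (λ x → 2 * (suc m * n * x * 3 ^ D²)) merge ⟩
  2 * (suc m * n * 2 ^ e * 3 ^ D²)        ≤⟨ *-monoʳ-≤ 2 (*-monoˡ-≤ (3 ^ D²) (*-monoˡ-≤ (2 ^ e) mn≤2^2t)) ⟩
  2 * (2 ^ (2 * t) * 2 ^ e * 3 ^ D²)      ≡⟨ cong (λ x → 2 * (x * 3 ^ D²)) (^-distribˡ-+-* 2 (2 * t) e) ⟨
  2 * (2 ^ (2 * t + e) * 3 ^ D²)          ≤⟨ *-monoʳ-≤ 2 (*-monoˡ-≤ (3 ^ D²) (^-monoʳ-≤ 2 (box-exponent t n 32≤t n≤))) ⟩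
  2 * (2 ^ (40 * (t * t)) * 3 ^ D²)       ≡⟨ cong (λ x → 2 * (x * 3 ^ D²)) (trans (cong (2 ^_) (*-assoc 2 20 (t * t))) (sym (^-*-assoc 2 2 X))) ⟩
  2 * (4 ^ X * 3 ^ D²)                    ≤⟨ *-monoʳ-≤ 2 4^X·3^D²≤4^D² ⟩
  2 * 4 ^ D² ∎
  where
  open ≤-Reasoning
  D² = 10 * t * (10 * t)
  X = 20 * (t * t)
  e = n + n + (t * n + suc n)
  regroup : ∀ a n x y z → (2 * a) * (n * (x * x) * y * z) ≡ 2 * (a * n * (x * x * y) * z)
  regroup = solve 5 (λ a n x y z → (con 2 :* a) :* (n :* (x :* x) :* y :* z) := con 2 :* (a :* n :* (x :* x :* y) :* z)) refl
  merge : 2 ^ n * 2 ^ n * 2 ^ (t * n + suc n) ≡ 2 ^ e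
  merge = trans (cong (_* 2 ^ (t * n + suc n)) (sym (^-distribˡ-+-* 2 n n))) (sym (^-distribˡ-+-* 2 (n + n) _))
  mn≤2^2t : suc m * n ≤ 2 ^ (2 * t)
  mn≤2^2t = begin
    suc m * n                ≤⟨ *-monoʳ-≤ (suc m) (≤-trans n≤ (m≤m+n (32 * t + 31) _)) ⟩
    suc m * (32 * t + 31 + (8160 * t + 4065 + 4096 * t * t))
      ≡⟨ solve 2 (λ a t → a :* (con 32 :* t :+ con 31 :+ (con 8160 :* t :+ con 4065 :+ con 4096 :* t :* t)) := con 4096 :* a :* ((con 1 :+ t) :* (con 1 :+ t))) refl (suc m) t ⟩
    4096 * suc m * (suc t * suc t) ≤⟨ poly≤4^ (4096 * suc m) t large ⟩
    4 ^ t                    ≡⟨ ^-*-assoc 2 2 t ⟩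
    2 ^ (2 * t) ∎
  D²≡5X : D² ≡ 5 * X
  D²≡5X = solve 1 (λ t → con 10 :* t :* (con 10 :* t) := con 5 :* (con 20 :* (t :* t))) refl t
  4^X·3^D²≤4^D² : 4 ^ X * 3 ^ D² ≤ 4 ^ D²
  4^X·3^D²≤4^D² = begin
    4 ^ X * 3 ^ D²        ≡⟨ cong (λ y → 4 ^ X * 3 ^ y) D²≡5X ⟩
    4 ^ X * 3 ^ (5 * X)   ≡⟨ cong (4 ^ X *_) (sym (^-*-assoc 3 5 X)) ⟩
    4 ^ X * (3 ^ 5) ^ X   ≡⟨ trans (*-comm (4 ^ X) _) (sym (*-^-distrib (3 ^ 5) 4 X)) ⟩
    (3 ^ 5 * 4) ^ X       ≤⟨ ^-monoˡ-≤ X (≤ᵇ⇒≤ (3 ^ 5 * 4) (4 ^ 5) tt) ⟩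
    (4 ^ 5) ^ X           ≡⟨ ^-*-assoc 4 5 X ⟩
    4 ^ (5 * X)           ≡⟨ cong (4 ^_) (sym D²≡5X) ⟩
    4 ^ D² ∎

DifferentFamilies : ∀ {n} → Family n → Family n → Set
DifferentFamilies = Differ (Differ (Differ (λ (x y : Bool) → x ≢ y)))

allFamilies-distinct : ∀ n → AllPairs DifferentFamilies (allFamilies n)
allFamilies-distinct n =
  functions-distinct {R = Differ (Differ (λ (x y : Bool) → x ≢ y))} _
    (functions-distinct {R = Differ (λ (x y : Bool) → x ≢ y)} _
      (functions-distinct {R = λ (x y : Bool) → x ≢ y} bools (((λ ()) ∷ []) ∷ [] ∷ []) n) n) n

fromSlices-distinct : ∀ {n} {G G' : Family n} → DifferentFamilies G G' → fromSlices G ≢ fromSlices G'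
fromSlices-distinct {G = G} {G'} (s , a , c , G≢G') same =
  G≢G' (subst (λ x → G x a c ≡ G' x a c) (⊕-⊖-cancelˡ a s) (cong (λ H → H (a , a ⊕ s , c)) same))

scale-bound : ∀ x W Y Z M → .{{NonZero W}} → x * W ≤ Y * Z → M * Y ≤ W → M * x ≤ Z
scale-bound x W Y Z M xW≤YZ MY≤W = *-cancelʳ-≤ (M * x) Z W (begin
  M * x * W    ≡⟨ *-assoc M x W ⟩
  M * (x * W)  ≤⟨ *-monoʳ-≤ M xW≤YZ ⟩
  M * (Y * Z)  ≡⟨ *-assoc M Y Z ⟨
  M * Y * Z    ≤⟨ *-monoˡ-≤ Z MY≤W ⟩
  W * Z        ≡⟨ *-comm W Z ⟩
  Z * W ∎)
  where open ≤-Reasoning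

2*4^-nonZero : ∀ x → NonZero (2 * 4 ^ x)
2*4^-nonZero x = >-nonZero (*-mono-< {0} {2} {0} {4 ^ x} (s≤s z≤n) (m^n>0 4 x))

module Scale (m t n : ℕ) (t-large : 4096 * suc m + 38 ≤ t) (32t≤n : 32 * t ≤ n) (n≤32t+31 : n ≤ 32 * t + 31) where

  open Events n (10 * t) t

  typical-many-matchings : ∀ G → typical G ≡ true → HasManyDisjointPMs 1 64 n (fromSlices G)
  typical-many-matchings G is-typical =
    lift-disjoint-matchings 1 64 G (λ s → disjoint-matchings t (G s) (typical-wellConnected G is-typical s)) enough
    where
    n≤64t : n ≤ 64 * t
    n≤64t = ≤-trans n≤32t+31 (≤-trans (+-monoʳ-≤ (32 * t) (≤-trans (≤ᵇ⇒≤ 31 32 tt) (*-monoʳ-≤ 32 1≤t)))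
      (≤-reflexive (solve 1 (λ t → con 32 :* t :+ con 32 :* t := con 64 :* t) refl t)))
      where
      1≤t : 1 ≤ t
      1≤t = ≤-trans (s≤s z≤n) t-large
    enough : 1 * (n * n) ≤ 64 * (n * t)
    enough = ≤-trans (≤-reflexive (*-identityˡ (n * n))) (≤-trans (*-monoʳ-≤ n n≤64t)
      (≤-reflexive (solve 2 (λ n t → n :* (con 64 :* t) := con 64 :* (n :* t)) refl n t)))

  atypical-rare : suc m * countOver (not ∘ typical) (allFamilies n) ≤ 2 ^ N
  atypical-rare = *-cancelˡ-≤ 2 (begin
    2 * (suc m * countOver (not ∘ typical) (allFamilies n)) ≤⟨ *-monoʳ-≤ 2 (*-monoʳ-≤ (suc m) atypical-split) ⟩
    2 * (suc m * (r + c + b))   ≡⟨ solve 4 (λ s r c b → con 2 :* (s :* (r :+ c :+ b)) := con 2 :* s :* (r :+ c) :+ con 2 :* s :* b) refl (suc m) r c b ⟩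
    M * (r + c) + M * b         ≤⟨ +-mono-≤ degrees boxes ⟩
    2 ^ N + 2 ^ N               ≡⟨ solve 1 (λ x → x :+ x := con 2 :* x) refl (2 ^ N) ⟩
    2 * 2 ^ N ∎)
    where
    open ≤-Reasoning
    r = sumOver frequency rowEvents
    c = sumOver frequency colEvents
    b = sumOver frequency boxEvents
    M = 2 * suc m
    t≥6 : 4096 * suc m + 6 ≤ t
    t≥6 = ≤-trans (+-monoʳ-≤ (4096 * suc m) (≤ᵇ⇒≤ 6 38 tt)) t-large
    degrees : M * (r + c) ≤ 2 ^ N
    degrees = scale-bound (r + c) (2 * 4 ^ n) (2 * (n * n) * 2 ^ (t + 10 * t) * 3 ^ n) (2 ^ N) M {{2*4^-nonZero n}}
      (begin
        (r + c) * (2 * 4 ^ n)                                    ≡⟨ *-distribʳ-+ (2 * 4 ^ n) r c ⟩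
        r * (2 * 4 ^ n) + c * (2 * 4 ^ n)                        ≤⟨ +-mono-≤ row-frequencies col-frequencies ⟩
        n * n * (2 ^ (t + 10 * t) * 2 ^ N * 3 ^ n) + n * n * (2 ^ (t + 10 * t) * 2 ^ N * 3 ^ n)
          ≡⟨ solve 4 (λ a x y z → a :* (x :* y :* z) :+ a :* (x :* y :* z) := con 2 :* a :* x :* z :* y) refl (n * n) (2 ^ (t + 10 * t)) (2 ^ N) (3 ^ n) ⟩
        2 * (n * n) * 2 ^ (t + 10 * t) * 3 ^ n * 2 ^ N ∎)
      (degree-events-rare m t n t≥6 32t≤n n≤32t+31)
    boxes : M * b ≤ 2 ^ N
    boxes = scale-bound b (2 * 4 ^ (10 * t * (10 * t))) (n * (2 ^ n * 2 ^ n) * 2 ^ (t * n + suc n) * 3 ^ (10 * t * (10 * t))) (2 ^ N) M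
      {{2*4^-nonZero (10 * t * (10 * t))}}
      (≤-trans box-frequencies (≤-reflexive (solve 4 (λ a x y z → a :* (x :* y :* z) := a :* x :* z :* y) refl
        (n * (2 ^ n * 2 ^ n)) (2 ^ (t * n + suc n)) (2 ^ N) (3 ^ (10 * t * (10 * t))))))
      (box-events-rare m t n t≥6 (≤-trans (≤ᵇ⇒≤ 32 38 tt) (≤-trans (m≤n+m 38 (4096 * suc m)) t-large)) n≤32t+31)

  typical-hypergraphs : Σ (List (Hypergraph n)) λ L → Unique L × All (HasManyDisjointPMs 1 64 n) L
                          × (suc m * (2 ^ (n * n * n) ∸ length L) ≤ 2 ^ (n * n * n))
  typical-hypergraphs = L , distinct , many , rare
    where
    L = map fromSlices (filterᵇ typical (allFamilies n))
    distinct : Unique L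
    distinct = AllPairsₚ.map⁺ (AllPairs.map fromSlices-distinct (AllPairsₚ.filter⁺ _ (allFamilies-distinct n)))
    many : All (HasManyDisjointPMs 1 64 n) L
    many = Allₚ.map⁺ (All.map (λ {G} is-typical → typical-many-matchings G (Equivalence.to Boolₚ.T-≡ is-typical))
                               (Allₚ.all-filter _ (allFamilies n)))
    missing-count : 2 ^ N ∸ length L ≡ countOver (not ∘ typical) (allFamilies n)
    missing-count = begin-equality
      2 ^ N ∸ length L
        ≡⟨ cong₂ _∸_ (trans (sym (length-allFamilies n)) (sym (countOver-complement typical (allFamilies n))))
                     (trans (Listₚ.length-map fromSlices (filterᵇ typical (allFamilies n))) (length-filterᵇ typical (allFamilies n))) ⟩
      countOver typical (allFamilies n) + countOver (not ∘ typical) (allFamilies n) ∸ countOver typical (allFamilies n)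
        ≡⟨ m+n∸m≡n (countOver typical (allFamilies n)) _ ⟩
      countOver (not ∘ typical) (allFamilies n) ∎
      where open ≤-Reasoning
    rare : suc m * (2 ^ N ∸ length L) ≤ 2 ^ N
    rare = subst (λ x → suc m * x ≤ 2 ^ N) (sym missing-count) atypical-rare

lemma7p2 : Σ ℕ λ p → Σ ℕ λ q → (0 < p) × (0 < q) ×
  (∀ (m : ℕ) → ∃[ N ] ∀ (n : ℕ) → N ≤ n →
     Σ (List (Hypergraph n)) λ L →
         Unique L
       × All (HasManyDisjointPMs p q n) L
       × (suc m * (2 ^ (n * n * n) ∸ length L) ≤ 2 ^ (n * n * n)))
lemma7p2 = 1 , 64 , s≤s z≤n , s≤s z≤n , λ m → start m * 32 ,
  λ n N≤n → Scale.typical-hypergraphs m (n / 32) n (scale-large m n N≤n) (32[n/32]≤n n) (n≤32[n/32]+31 n)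
  where
  start : ℕ → ℕ
  start m = 4096 * suc m + 38
  scale-large : ∀ m n → start m * 32 ≤ n → start m ≤ n / 32
  scale-large m n le = subst (_≤ n / 32) (m*n/n≡m (start m) 32) (/-monoˡ-≤ 32 le)
  32[n/32]≤n : ∀ n → 32 * (n / 32) ≤ n
  32[n/32]≤n n = subst (_≤ n) (*-comm (n / 32) 32) (m/n*n≤m n 32)
  n≤32[n/32]+31 : ∀ n → n ≤ 32 * (n / 32) + 31
  n≤32[n/32]+31 n = begin
    n                        ≡⟨ m≡m%n+[m/n]*n n 32 ⟩
    n % 32 + n / 32 * 32     ≤⟨ +-monoˡ-≤ (n / 32 * 32) (≤-pred (m%n<n n 32)) ⟩
    31 + n / 32 * 32         ≡⟨ trans (+-comm 31 _) (cong (_+ 31) (*-comm (n / 32) 32)) ⟩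
    32 * (n / 32) + 31 ∎
    where open ≤-Reasoning
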